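{- Let $p\ge1$ and let $k_1,\dots,k_p,r_1,\dots,r_p\ge0$ be integers with $k=k_1+\cdots+k_p$ and $r=r_1+\cdots+r_p$, and let $s\ge1$ and $n\ge sk$ be integers. Then \[ \binom{k}{k_1,\dots,k_p}L^{(s)}_r(n+r,k+r)=\sum_{\substack{l_1+\cdots+l_p=n\\ l_i\ge sk_i+(s-1)r_i}}\binom{n}{l_1,\dots,l_p}\prod_{i=1}^{p}L^{(s)}_{r_i}(l_i+r_i,k_i+r_i). \]
   Context: Fix an integer $s\ge1$. For integers $n,k,r\ge0$, $L^{(s)}_r(n,k)$ is the number of partitions of $\{1,\dots,n\}$ into exactly $k$ ordered lists (nonempty blocks each with a linear order, the set of blocks unordered) such that $1,\dots,r$ lie in pairwise distinct lists and every list has at least $s$ elements. Multinomial coefficients are the usual ones; the sum is over integers $l_1,\dots,l_p$. -}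

module Defs where

open import Data.Bool using (Bool; true; false; _∧_)
open import Data.Nat using (ℕ; zero; suc; _+_; _*_; _∸_; _⊓_; _≤ᵇ_; _<ᵇ_)
open import Data.Nat.Combinatorics using (_C_)
open import Data.List as List using (List; []; _∷_; length; map; concatMap; take; drop; upTo; filterᵇ)

open import Data.Bool.ListAction using (and)
open import Data.Vec as Vec using (Vec; []; _∷_)

-- A partition into unordered ordered-lists is represented canonically
-- as the list of its blocks sorted by increasing minimal element.
-- Every such canonical list is obtained exactly once as
--   (a permutation of [1,…,n]) cut into k nonempty consecutive chunks.

insertions : ℕ → List ℕ → List (List ℕ)
insertions x [] = (x ∷ []) ∷ []
insertions x (y ∷ ys) = (x ∷ y ∷ ys) ∷ map (y ∷_) (insertions x ys)

perms : List ℕ → List (List ℕ)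
perms [] = [] ∷ []
perms (x ∷ xs) = concatMap (insertions x) (perms xs)

splits : ℕ → List ℕ → List (List (List ℕ))
splits zero [] = [] ∷ []
splits zero (_ ∷ _) = []
splits (suc k) xs =
  concatMap (λ i → map (take i xs ∷_) (splits k (drop i xs)))
            (map suc (upTo (length xs)))

oneTo : ℕ → List ℕ
oneTo n = map suc (upTo n)

minL : List ℕ → ℕ
minL [] = 0
minL (x ∷ xs) = List.foldr _⊓_ x xs

increasingMins : List (List ℕ) → Bool
increasingMins [] = true
increasingMins (_ ∷ []) = true
increasingMins (b ∷ c ∷ bs) = (minL b <ᵇ minL c) ∧ increasingMins (c ∷ bs)

countLe : ℕ → List ℕ → ℕ
countLe r b = length (filterᵇ (λ x → x ≤ᵇ r) b)

-- validity: every list has ≥ s elements, 1,…,r in pairwise distinct lists,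
-- blocks in canonical order
valid : ℕ → ℕ → List (List ℕ) → Bool
valid s r bs =
  and (map (λ b → s ≤ᵇ length b) bs) ∧ and (map (λ b → countLe r b ≤ᵇ 1) bs) ∧ increasingMins bs

LStructs : (s n k r : ℕ) → List (List (List ℕ))
LStructs s n k r = filterᵇ (valid s r) (concatMap (splits k) (perms (oneTo n)))

L : (s r n k : ℕ) → ℕ
L s r n k = length (LStructs s n k r)

multinomial : ∀ {p} → Vec ℕ p → ℕ
multinomial [] = 1
multinomial (a ∷ as) = ((a + Vec.sum as) C a) * multinomial as

weakComps : (p n : ℕ) → List (Vec ℕ p)
weakComps zero zero = [] ∷ []
weakComps zero (suc _) = []
weakComps (suc p) n =
  concatMap (λ a → map (a ∷_) (weakComps p (n ∸ a))) (upTo (suc n))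

admissible : ∀ {p} → (s : ℕ) → Vec ℕ p → Vec ℕ p → Vec ℕ p → Bool
admissible s [] [] [] = true
admissible s (k ∷ ks) (r ∷ rs) (l ∷ ls) =
  ((s * k + (s ∸ 1) * r) ≤ᵇ l) ∧ admissible s ks rs ls

prodL : ∀ {p} → (s : ℕ) → Vec ℕ p → Vec ℕ p → Vec ℕ p → ℕ
prodL s [] [] [] = 1
prodL s (k ∷ ks) (r ∷ rs) (l ∷ ls) = L s r (l + r) (k + r) * prodL s ks rs ls

sumL : List ℕ → ℕ
sumL = List.foldr _+_ 0

rhsSum : ∀ {p} → (s n : ℕ) → Vec ℕ p → Vec ℕ p → ℕ
rhsSum {p} s n ks rs =
  sumL (map (λ ls → multinomial ls * prodL s ks rs ls)
                (filterᵇ (admissible s ks rs) (weakComps p n)))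

module Submission where

-- Build a structure counted by L⁽ˢ⁾ᵣ(n+r, k+r) by adding the elements 1,2,… in
-- increasing order.  Each of the special elements 1,…,r must open its own list; each of
-- the other n elements either opens one of the k remaining lists or joins an open one.
-- At the end a list of size a can be ordered in a! ways, admissibly iff a ≥ s.  This
-- gives L⁽ˢ⁾ᵣ(n+r, k+r) = grow n (1,…,1) k for an explicit recursion grow (module
-- Enumeration, lemma L≡grow).  For grow a binomial convolution identity holds
-- (Growth.convolution: distributing elements between two independent processes),
-- proved by induction with Pascal's rule; iterated over the p parts it becomes the
-- multinomial identity (Growth.multinomial-convolution).  The restriction
-- lᵢ ≥ s kᵢ + (s−1) rᵢ only removes vanishing terms (Growth.inadmissible-vanish).

open import Defs
open import Data.Nat using (ℕ; _+_; _*_; _≤_)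
open import Data.Vec using (Vec; sum)
open import Relation.Binary.PropositionalEquality using (_≡_)

open import Data.Bool using (Bool; true; false; _∧_; T)
open import Data.Bool.Properties using (T?; ∧-zeroʳ; ∧-identityʳ)
open import Data.Bool.ListAction using (and)
open import Data.Empty using (⊥; ⊥-elim)
open import Data.List as List
  using (List; []; _∷_; _++_; length; map; upTo; applyUpTo; concatMap; filterᵇ; take; drop; replicate)
open import Data.List.Properties using (map-∘; map-++; map-upTo; ++-assoc; length-++; length-map; filter-++; length-replicate; map-replicate)
open import Data.List.Relation.Unary.All as All using (All; []; _∷_)
import Data.List.Relation.Unary.All.Properties as All
open import Data.List.Relation.Unary.Any using (Any; here; there)
open import Data.List.Membership.Propositional using (_∈_)
import Data.List.Relation.Unary.Any.Properties as Any
open import Data.List.Relation.Binary.Permutation.Propositional as Perm using (_↭_)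
import Data.List.Relation.Binary.Permutation.Propositional.Properties as Perm
open import Data.Maybe using (Maybe; just; nothing)
open import Data.Nat
open import Data.Nat.Combinatorics using (_C_; nCk+nC[k+1]≡[n+1]C[k+1]; nCn≡1)
open import Data.Nat.Combinatorics.Specification using (k>n⇒nCk≡0)
open import Data.Nat.ListAction using (product)
open import Data.Nat.ListAction.Properties using (sum-++; product-++; product-↭)
open import Data.Nat.Properties
open import Algebra.Properties.CommutativeSemigroup +-commutativeSemigroup
  using () renaming (interchange to +-interchange; x∙yz≈y∙xz to +-left-comm)
open import Data.Nat.Tactic.RingSolver using (solve-∀)
open import Data.Product using (_×_; _,_; proj₁; proj₂)
open import Data.Sum using (inj₁; inj₂)
open import Data.Vec as Vec using ([]; _∷_)
open import Function using (_∘_; id)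
open import Relation.Binary.PropositionalEquality using (refl; sym; trans; cong; cong₂; subst; subst₂; _≢_; module ≡-Reasoning)
open import Relation.Nullary using (yes; no)

𝟙 : Bool → ℕ
𝟙 true = 1
𝟙 false = 0

𝟙-∧ : ∀ a b → 𝟙 (a ∧ b) ≡ 𝟙 a * 𝟙 b
𝟙-∧ true b = sym (+-identityʳ (𝟙 b))
𝟙-∧ false b = refl

∑ : {A : Set} → List A → (A → ℕ) → ℕ
∑ xs f = sumL (map f xs)

module _ {A : Set} where

  ∑-cong : (xs : List A) {f g : A → ℕ} → All (λ x → f x ≡ g x) xs → ∑ xs f ≡ ∑ xs g
  ∑-cong [] [] = refl
  ∑-cong (x ∷ xs) (p ∷ ps) = cong₂ _+_ p (∑-cong xs ps)

  ∑-cong′ : (xs : List A) {f g : A → ℕ} → (∀ x → f x ≡ g x) → ∑ xs f ≡ ∑ xs g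
  ∑-cong′ xs h = ∑-cong xs (All.tabulate (λ {x} _ → h x))

  ∑-+ : (xs : List A) (f g : A → ℕ) → ∑ xs (λ x → f x + g x) ≡ ∑ xs f + ∑ xs g
  ∑-+ [] f g = refl
  ∑-+ (x ∷ xs) f g rewrite ∑-+ xs f g = +-interchange (f x) (g x) (∑ xs f) (∑ xs g)

  ∑-const : (xs : List A) (c : ℕ) → ∑ xs (λ _ → c) ≡ length xs * c
  ∑-const [] c = refl
  ∑-const (x ∷ xs) c = cong (c +_) (∑-const xs c)

  ∑-zero : (xs : List A) → ∑ xs (λ _ → 0) ≡ 0
  ∑-zero xs = trans (∑-const xs 0) (*-zeroʳ (length xs))

  ∑-*ˡ : (xs : List A) (c : ℕ) (f : A → ℕ) → ∑ xs (λ x → c * f x) ≡ c * ∑ xs f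
  ∑-*ˡ [] c f = sym (*-zeroʳ c)
  ∑-*ˡ (x ∷ xs) c f rewrite ∑-*ˡ xs c f = sym (*-distribˡ-+ c (f x) (∑ xs f))

  ∑-*ʳ : (xs : List A) (c : ℕ) (f : A → ℕ) → ∑ xs (λ x → f x * c) ≡ ∑ xs f * c
  ∑-*ʳ [] c f = refl
  ∑-*ʳ (x ∷ xs) c f rewrite ∑-*ʳ xs c f = sym (*-distribʳ-+ c (f x) (∑ xs f))

  ∑-map : {B : Set} (xs : List A) (g : A → B) (f : B → ℕ) → ∑ (map g xs) f ≡ ∑ xs (f ∘ g)
  ∑-map xs g f = cong sumL (sym (map-∘ xs))

  ∑-concatMap : {B : Set} (xs : List A) (g : A → List B) (f : B → ℕ) →
                ∑ (concatMap g xs) f ≡ ∑ xs (λ x → ∑ (g x) f)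
  ∑-concatMap [] g f = refl
  ∑-concatMap (x ∷ xs) g f =
    trans (cong sumL (map-++ f (g x) (concatMap g xs)))
          (trans (sum-++ (map f (g x)) _) (cong (∑ (g x) f +_) (∑-concatMap xs g f)))

  ∑-filter : (P : A → Bool) (f : A → ℕ) (xs : List A) → (∀ x → P x ≡ false → f x ≡ 0) →
             ∑ (filterᵇ P xs) f ≡ ∑ xs f
  ∑-filter P f [] vanish = refl
  ∑-filter P f (x ∷ xs) vanish with P x in eq
  ... | true = cong (f x +_) (∑-filter P f xs vanish)
  ... | false = trans (∑-filter P f xs vanish) (sym (cong (_+ ∑ xs f) (vanish x eq)))

  length-filter-concatMap : {B : Set} (P : B → Bool) (g : A → List B) (xs : List A) →
    length (filterᵇ P (concatMap g xs)) ≡ ∑ xs (λ x → length (filterᵇ P (g x)))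
  length-filter-concatMap P g [] = refl
  length-filter-concatMap P g (x ∷ xs) =
    trans (cong length (filter-++ (T? ∘ P) (g x) (concatMap g xs)))
          (trans (length-++ (filterᵇ P (g x)))
                 (cong (length (filterᵇ P (g x)) +_) (length-filter-concatMap P g xs)))

  length-filter-cong : (P Q : A → Bool) → (∀ x → P x ≡ Q x) → ∀ xs →
                       length (filterᵇ P xs) ≡ length (filterᵇ Q xs)
  length-filter-cong P Q h [] = refl
  length-filter-cong P Q h (x ∷ xs) with P x | Q x | h x
  ... | true | .true | refl = cong suc (length-filter-cong P Q h xs)
  ... | false | .false | refl = length-filter-cong P Q h xs

  length-filter-map-∧ : {B : Set} (P : B → Bool) (g : A → B) (b : Bool) (Q : A → Bool) → (∀ y → P (g y) ≡ b ∧ Q y) →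
                        ∀ ys → length (filterᵇ P (map g ys)) ≡ 𝟙 b * length (filterᵇ Q ys)
  length-filter-map-∧ P g b Q h [] = sym (*-zeroʳ (𝟙 b))
  length-filter-map-∧ P g b Q h (y ∷ ys) with P (g y) | h y
  ... | _ | e with b | Q y | e
  ...   | false | _ | refl = length-filter-map-∧ P g false Q h ys
  ...   | true | true | refl = cong suc (length-filter-map-∧ P g true Q h ys)
  ...   | true | false | refl = length-filter-map-∧ P g true Q h ys

sumTo : ℕ → (ℕ → ℕ) → ℕ
sumTo zero f = 0
sumTo (suc n) f = f 0 + sumTo n (f ∘ suc)

∑-upTo : ∀ n (f : ℕ → ℕ) → ∑ (upTo n) f ≡ sumTo n f
∑-upTo n f = trans (cong sumL (map-upTo f n)) (sumL-applyUpTo n f)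
  where
  sumL-applyUpTo : ∀ n f → sumL (applyUpTo f n) ≡ sumTo n f
  sumL-applyUpTo zero f = refl
  sumL-applyUpTo (suc n) f = cong (f 0 +_) (sumL-applyUpTo n (f ∘ suc))

sumTo-cong : ∀ n {f g : ℕ → ℕ} → (∀ a → a < n → f a ≡ g a) → sumTo n f ≡ sumTo n g
sumTo-cong zero h = refl
sumTo-cong (suc n) h = cong₂ _+_ (h 0 z<s) (sumTo-cong n (λ a a<n → h (suc a) (s<s a<n)))

sumTo-cong′ : ∀ n {f g : ℕ → ℕ} → (∀ a → f a ≡ g a) → sumTo n f ≡ sumTo n g
sumTo-cong′ n h = sumTo-cong n (λ a _ → h a)

sumTo-+ : ∀ n (f g : ℕ → ℕ) → sumTo n (λ a → f a + g a) ≡ sumTo n f + sumTo n g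
sumTo-+ n f g = trans (sym (∑-upTo n _)) (trans (∑-+ (upTo n) f g) (cong₂ _+_ (∑-upTo n f) (∑-upTo n g)))

sumTo-*ˡ : ∀ n c (f : ℕ → ℕ) → sumTo n (λ a → c * f a) ≡ c * sumTo n f
sumTo-*ˡ n c f = trans (sym (∑-upTo n _)) (trans (∑-*ˡ (upTo n) c f) (cong (c *_) (∑-upTo n f)))

sumTo-zero : ∀ n → sumTo n (λ _ → 0) ≡ 0
sumTo-zero n = trans (sym (∑-upTo n _)) (∑-zero (upTo n))

sumTo-suc : ∀ n f → sumTo (suc n) f ≡ sumTo n f + f n
sumTo-suc zero f = +-comm (f 0) 0
sumTo-suc (suc n) f = trans (cong (f 0 +_) (sumTo-suc n (f ∘ suc))) (sym (+-assoc (f 0) _ _))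

binConv : ℕ → (ℕ → ℕ → ℕ) → ℕ
binConv M F = sumTo (suc M) (λ a → (M C a) * F a (M ∸ a))

binConv-cong : ∀ M {F G : ℕ → ℕ → ℕ} → (∀ i j → F i j ≡ G i j) → binConv M F ≡ binConv M G
binConv-cong M h = sumTo-cong′ (suc M) (λ a → cong ((M C a) *_) (h a (M ∸ a)))

binConv-+ : ∀ M (F G : ℕ → ℕ → ℕ) → binConv M (λ i j → F i j + G i j) ≡ binConv M F + binConv M G
binConv-+ M F G =
  trans (sumTo-cong′ (suc M) (λ a → *-distribˡ-+ (M C a) (F a (M ∸ a)) (G a (M ∸ a))))
        (sumTo-+ (suc M) (λ a → (M C a) * F a (M ∸ a)) (λ a → (M C a) * G a (M ∸ a)))

binConv-zero : ∀ M (F : ℕ → ℕ → ℕ) → (∀ i j → F i j ≡ 0) → binConv M F ≡ 0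
binConv-zero M F h =
  trans (sumTo-cong′ (suc M) (λ a → trans (cong ((M C a) *_) (h a (M ∸ a))) (*-zeroʳ (M C a))))
        (sumTo-zero (suc M))

-- Leibniz rule: by Pascal's rule a convolution of total weight M+1 splits
-- according to which argument received the last unit.
binConv-suc : ∀ M F → binConv (suc M) F ≡ binConv M (λ i j → F i (suc j)) + binConv M (λ i j → F (suc i) j)
binConv-suc M F = begin
  1 * F 0 (suc M) + sumTo (suc M) (λ a → (suc M C suc a) * F (suc a) (M ∸ a))
    ≡⟨ cong (1 * F 0 (suc M) +_) (trans (sumTo-cong′ (suc M) pascal) (sumTo-+ (suc M) g (λ a → (M C a) * F (suc a) (M ∸ a)))) ⟩
  1 * F 0 (suc M) + (sumTo (suc M) g + X)
    ≡⟨ cong (λ z → 1 * F 0 (suc M) + (z + X)) (sumTo-suc M g) ⟩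
  1 * F 0 (suc M) + ((sumTo M g + (M C suc M) * F (suc M) (M ∸ M)) + X)
    ≡⟨ cong (λ z → 1 * F 0 (suc M) + ((sumTo M g + z * F (suc M) (M ∸ M)) + X)) (k>n⇒nCk≡0 (n<1+n M)) ⟩
  1 * F 0 (suc M) + ((sumTo M g + 0) + X)
    ≡⟨ cong (λ z → 1 * F 0 (suc M) + (z + X)) (+-identityʳ (sumTo M g)) ⟩
  1 * F 0 (suc M) + (sumTo M g + X)
    ≡⟨ sym (+-assoc (1 * F 0 (suc M)) _ X) ⟩
  1 * F 0 (suc M) + sumTo M g + X
    ≡⟨ cong (λ z → 1 * F 0 (suc M) + z + X) (sumTo-cong M (λ a a<M → cong (λ z → (M C suc a) * F (suc a) z) (M∸a≡1+M∸[1+a] {a} {M} a<M))) ⟩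
  binConv M (λ i j → F i (suc j)) + X ∎
  where
  open ≡-Reasoning
  g : ℕ → ℕ
  g a = (M C suc a) * F (suc a) (M ∸ a)
  X : ℕ
  X = binConv M (λ i j → F (suc i) j)
  pascal : ∀ a → (suc M C suc a) * F (suc a) (M ∸ a) ≡ g a + (M C a) * F (suc a) (M ∸ a)
  pascal a = trans (cong (_* F (suc a) (M ∸ a)) (trans (sym (nCk+nC[k+1]≡[n+1]C[k+1] M a)) (+-comm (M C a) (M C suc a))))
                   (*-distribʳ-+ (F (suc a) (M ∸ a)) (M C suc a) (M C a))
  M∸a≡1+M∸[1+a] : ∀ {a M} → a < M → M ∸ a ≡ suc (M ∸ suc a)
  M∸a≡1+M∸[1+a] {zero} {suc M} _ = refl
  M∸a≡1+M∸[1+a] {suc a} {suc M} (s≤s a<M) = M∸a≡1+M∸[1+a] a<M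

T⇒≡true : ∀ {b} → T b → b ≡ true
T⇒≡true {true} _ = refl

¬T⇒≡false : ∀ {b} → (T b → ⊥) → b ≡ false
¬T⇒≡false {true} ¬t = ⊥-elim (¬t _)
¬T⇒≡false {false} _ = refl

<ᵇ-true : ∀ {m n} → m < n → (m <ᵇ n) ≡ true
<ᵇ-true m<n = T⇒≡true (<⇒<ᵇ m<n)

<ᵇ-false : ∀ {m n} → n ≤ m → (m <ᵇ n) ≡ false
<ᵇ-false {m} {n} n≤m = ¬T⇒≡false (λ t → <⇒≱ (<ᵇ⇒< m n t) n≤m)

≤ᵇ-true : ∀ {m n} → m ≤ n → (m ≤ᵇ n) ≡ true
≤ᵇ-true m≤n = T⇒≡true (≤⇒≤ᵇ m≤n)

≤ᵇ-false : ∀ {m n} → n < m → (m ≤ᵇ n) ≡ false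
≤ᵇ-false {m} {n} n<m = ¬T⇒≡false (λ t → <⇒≱ n<m (≤ᵇ⇒≤ m n t))

minL-lb : ∀ {b} π → π ≢ [] → All (b ≤_) π → b ≤ minL π
minL-lb [] π≢[] _ = ⊥-elim (π≢[] refl)
minL-lb (x ∷ xs) _ (b≤x ∷ b≤xs) = foldr-lb xs b≤x b≤xs
  where
  foldr-lb : ∀ {b x} xs → b ≤ x → All (b ≤_) xs → b ≤ List.foldr _⊓_ x xs
  foldr-lb [] b≤x [] = b≤x
  foldr-lb (y ∷ ys) b≤x (b≤y ∷ b≤ys) = ⊓-glb b≤y (foldr-lb ys b≤x b≤ys)

minL-ub : ∀ π {y} → y ∈ π → minL π ≤ y
minL-ub (x ∷ xs) (here refl) = foldr-≤-seed x xs
  where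
  foldr-≤-seed : ∀ x xs → List.foldr _⊓_ x xs ≤ x
  foldr-≤-seed x [] = ≤-refl
  foldr-≤-seed x (y ∷ ys) = ≤-trans (m⊓n≤n y _) (foldr-≤-seed x ys)
minL-ub (x ∷ xs) (there y∈xs) = foldr-≤-elem xs y∈xs
  where
  foldr-≤-elem : ∀ {x y} zs → y ∈ zs → List.foldr _⊓_ x zs ≤ y
  foldr-≤-elem (z ∷ zs) (here refl) = m⊓n≤m z _
  foldr-≤-elem (z ∷ zs) (there p) = ≤-trans (m⊓n≤n z _) (foldr-≤-elem zs p)

module _ (m : ℕ) where

  insertions-length : ∀ w → length (insertions m w) ≡ suc (length w)
  insertions-length [] = refl
  insertions-length (y ∷ ys) = cong suc (trans (length-map (y ∷_) (insertions m ys)) (insertions-length ys))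

  insertion-length : ∀ w → All (λ π → length π ≡ suc (length w)) (insertions m w)
  insertion-length [] = refl ∷ []
  insertion-length (y ∷ ys) = refl ∷ All.map⁺ (All.map (cong suc) (insertion-length ys))

  insertion-∈ : ∀ w → All (m ∈_) (insertions m w)
  insertion-∈ [] = here refl ∷ []
  insertion-∈ (y ∷ ys) = here refl ∷ All.map⁺ (All.map there (insertion-∈ ys))

  insertion-All : {P : ℕ → Set} → ∀ w → P m → All P w → All (All P) (insertions m w)
  insertion-All [] pm [] = (pm ∷ []) ∷ []
  insertion-All (y ∷ ys) pm (py ∷ pys) = (pm ∷ py ∷ pys) ∷ All.map⁺ (All.map (py ∷_) (insertion-All ys pm pys))

  insertion-minL : ∀ w → All (m ≤_) w → All (λ π → minL π ≡ m) (insertions m w)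
  insertion-minL w m≤w = All.zipWith minL≡m
    (insertion-∈ w , All.zip (insertion-length w , insertion-All w ≤-refl m≤w))
    where
    minL≡m : ∀ {π} → m ∈ π × (length π ≡ suc (length w) × All (m ≤_) π) → minL π ≡ m
    minL≡m {π} (m∈π , len , m≤π) = ≤-antisym (minL-ub π m∈π) (minL-lb π (λ { refl → 0≢1+n len }) m≤π)

  insertion-countLe : ∀ r w → All (λ π → countLe r π ≡ countLe r w + countLe r (m ∷ [])) (insertions m w)
  insertion-countLe r [] = refl ∷ []
  insertion-countLe r (y ∷ ys) =
    trans (countLe-∷ r m (y ∷ ys)) (+-comm (countLe r (m ∷ [])) (countLe r (y ∷ ys)))
    ∷ All.map⁺ (All.map step (insertion-countLe r ys))
    where
    countLe-∷ : ∀ r y xs → countLe r (y ∷ xs) ≡ countLe r (y ∷ []) + countLe r xs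
    countLe-∷ r y xs with y ≤ᵇ r
    ... | true = refl
    ... | false = refl
    step : ∀ {π} → countLe r π ≡ countLe r ys + countLe r (m ∷ []) →
           countLe r (y ∷ π) ≡ countLe r (y ∷ ys) + countLe r (m ∷ [])
    step {π} e = begin
      countLe r (y ∷ π)                                          ≡⟨ countLe-∷ r y π ⟩
      countLe r (y ∷ []) + countLe r π                           ≡⟨ cong (countLe r (y ∷ []) +_) e ⟩
      countLe r (y ∷ []) + (countLe r ys + countLe r (m ∷ []))   ≡⟨ sym (+-assoc (countLe r (y ∷ [])) _ _) ⟩
      countLe r (y ∷ []) + countLe r ys + countLe r (m ∷ [])     ≡⟨ cong (_+ countLe r (m ∷ [])) (sym (countLe-∷ r y ys)) ⟩
      countLe r (y ∷ ys) + countLe r (m ∷ []) ∎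
      where open ≡-Reasoning

  sumIns : List ℕ → (List ℕ → ℕ) → ℕ
  sumIns w F = ∑ (insertions m w) F

  sumIns-const : ∀ w (F : List ℕ → ℕ) c → All (λ π → F π ≡ c) (insertions m w) → sumIns w F ≡ suc (length w) * c
  sumIns-const w F c h = trans (∑-cong (insertions m w) h) (trans (∑-const (insertions m w) c) (cong (_* c) (insertions-length w)))

  sumIns-zero : ∀ w (F : List ℕ → ℕ) → All (λ π → F π ≡ 0) (insertions m w) → sumIns w F ≡ 0
  sumIns-zero w F h = trans (sumIns-const w F 0 h) (*-zeroʳ (suc (length w)))

sumSplits : List ℕ → (List ℕ → List ℕ → ℕ) → ℕ
sumSplits [] G = G [] []
sumSplits (x ∷ xs) G = G [] (x ∷ xs) + sumSplits xs (λ u v → G (x ∷ u) v)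

sumSplits-cong : ∀ π {G H : List ℕ → List ℕ → ℕ} → (∀ u v → u ++ v ≡ π → G u v ≡ H u v) → sumSplits π G ≡ sumSplits π H
sumSplits-cong [] h = h [] [] refl
sumSplits-cong (x ∷ xs) h = cong₂ _+_ (h [] (x ∷ xs) refl) (sumSplits-cong xs (λ u v e → h (x ∷ u) v (cong (x ∷_) e)))

sumSplits-cong′ : ∀ π {G H : List ℕ → List ℕ → ℕ} → (∀ u v → G u v ≡ H u v) → sumSplits π G ≡ sumSplits π H
sumSplits-cong′ π h = sumSplits-cong π (λ u v _ → h u v)

sumSplits-+ : ∀ π (G H : List ℕ → List ℕ → ℕ) → sumSplits π (λ u v → G u v + H u v) ≡ sumSplits π G + sumSplits π H
sumSplits-+ [] G H = refl
sumSplits-+ (x ∷ xs) G H rewrite sumSplits-+ xs (λ u v → G (x ∷ u) v) (λ u v → H (x ∷ u) v) =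
  +-interchange (G [] (x ∷ xs)) (H [] (x ∷ xs)) _ _

sumSplits-zero : ∀ π → sumSplits π (λ _ _ → 0) ≡ 0
sumSplits-zero [] = refl
sumSplits-zero (x ∷ xs) = sumSplits-zero xs

sumSplits-take-drop : ∀ π (G : List ℕ → List ℕ → ℕ) →
  sumSplits π G ≡ G [] π + sumTo (length π) (λ i → G (take (suc i) π) (drop (suc i) π))
sumSplits-take-drop [] G = sym (+-identityʳ _)
sumSplits-take-drop (x ∷ xs) G = cong (G [] (x ∷ xs) +_) (sumSplits-take-drop xs (λ u v → G (x ∷ u) v))

sumIns-sumSplits : ∀ m w (G : List ℕ → List ℕ → ℕ) →
  sumIns m w (λ π → sumSplits π G) ≡ sumSplits w (λ u v → sumIns m u (λ u′ → G u′ v) + sumIns m v (λ v′ → G u v′))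
sumIns-sumSplits m [] G = rearrange (G [] (m ∷ [])) (G (m ∷ []) [])
  where
  rearrange : ∀ a b → a + b + 0 ≡ b + 0 + (a + 0)
  rearrange = solve-∀
sumIns-sumSplits m (y ∷ ys) G = begin
  sumIns m (y ∷ ys) (λ π → sumSplits π G)
    ≡⟨ cong (sumSplits (m ∷ y ∷ ys) G +_) (∑-map (insertions m ys) (y ∷_) (λ π → sumSplits π G)) ⟩
  sumSplits (m ∷ y ∷ ys) G + sumIns m ys (λ π → G [] (y ∷ π) + sumSplits π Gy)
    ≡⟨ cong (sumSplits (m ∷ y ∷ ys) G +_) (∑-+ (insertions m ys) _ _) ⟩
  (a₀ + (a₁ + a₂)) + (a₃ + sumIns m ys (λ π → sumSplits π Gy))
    ≡⟨ cong (λ z → (a₀ + (a₁ + a₂)) + (a₃ + z)) (sumIns-sumSplits m ys Gy) ⟩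
  (a₀ + (a₁ + a₂)) + (a₃ + a₄)
    ≡⟨ rearrange a₀ a₁ a₂ a₃ a₄ ⟩
  (a₁ + 0 + (a₀ + a₃)) + (a₂ + a₄)
    ≡⟨ cong ((a₁ + 0 + (a₀ + a₃)) +_) (sym (sumSplits-+ ys _ _)) ⟩
  (a₁ + 0 + (a₀ + a₃)) + sumSplits ys (λ u v → G (m ∷ y ∷ u) v + (sumIns m u (λ u′ → G (y ∷ u′) v) + sumIns m v (λ v′ → G (y ∷ u) v′)))
    ≡⟨ cong₂ (λ z w → (a₁ + 0 + (a₀ + z)) + w) (sym (∑-map (insertions m ys) (y ∷_) (G []))) (sumSplits-cong′ ys insertLeft) ⟩
  sumSplits (y ∷ ys) (λ u v → sumIns m u (λ u′ → G u′ v) + sumIns m v (λ v′ → G u v′)) ∎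
  where
  open ≡-Reasoning
  Gy : List ℕ → List ℕ → ℕ
  Gy u v = G (y ∷ u) v
  a₀ a₁ a₂ a₃ a₄ : ℕ
  a₀ = G [] (m ∷ y ∷ ys)
  a₁ = G (m ∷ []) (y ∷ ys)
  a₂ = sumSplits ys (λ u v → G (m ∷ y ∷ u) v)
  a₃ = sumIns m ys (λ π → G [] (y ∷ π))
  a₄ = sumSplits ys (λ u v → sumIns m u (λ u′ → G (y ∷ u′) v) + sumIns m v (λ v′ → G (y ∷ u) v′))
  rearrange : ∀ a₀ a₁ a₂ a₃ a₄ → (a₀ + (a₁ + a₂)) + (a₃ + a₄) ≡ (a₁ + 0 + (a₀ + a₃)) + (a₂ + a₄)
  rearrange = solve-∀
  insertLeft : ∀ u v → G (m ∷ y ∷ u) v + (sumIns m u (λ u′ → G (y ∷ u′) v) + sumIns m v (λ v′ → G (y ∷ u) v′))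
                     ≡ sumIns m (y ∷ u) (λ u′ → G u′ v) + sumIns m v (λ v′ → G (y ∷ u) v′)
  insertLeft u v = trans (sym (+-assoc (G (m ∷ y ∷ u) v) _ _))
                         (cong (_+ sumIns m v (λ v′ → G (y ∷ u) v′))
                               (cong (G (m ∷ y ∷ u) v +_) (sym (∑-map (insertions m u) (y ∷_) (λ u′ → G u′ v)))))

weakComps-sum : ∀ p n → All (λ ls → Vec.sum ls ≡ n) (weakComps p n)
weakComps-sum zero zero = refl ∷ []
weakComps-sum zero (suc n) = []
weakComps-sum (suc p) n =
  All.concat⁺ (All.map⁺ (All.applyUpTo⁺₁ id (suc n) (λ {a} a≤n →
    All.map⁺ (All.map (λ σ → trans (cong (a +_) σ) (m+[n∸m]≡n (s≤s⁻¹ a≤n))) (weakComps-sum p (n ∸ a))))))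

-- The growth recursion and its convolution identity

module Growth (s : ℕ) where

  -- fill a ℓ = (ℓ+1)(ℓ+2)⋯(ℓ+a)·[s ≤ ℓ+a] counts the ways to insert a new elements,
  -- one after the other, into an ordered list of ℓ elements, provided the final list
  -- has at least s elements.  So fill a 0 = a!·[s ≤ a] counts the admissible linear
  -- orders of an a-element list.
  fill : ℕ → ℕ → ℕ
  fill zero ℓ = 𝟙 (s ≤ᵇ ℓ)
  fill (suc a) ℓ = suc ℓ * fill a (suc ℓ)

  closeAll : List ℕ → ℕ
  closeAll as = product (map (λ a → fill a 0) as)

  bump : (List ℕ → ℕ) → List ℕ → ℕ
  bump g [] = 0
  bump g (a ∷ as) = g (suc a ∷ as) + bump (λ xs → g (a ∷ xs)) as

  mutual
    -- grow n as c counts the ways to distribute n further elements, taken in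
    -- increasing order, when the open lists have sizes as and c lists are still
    -- to be opened: every element either opens a new list or joins an open one,
    -- and at the end all lists are ordered admissibly.
    grow : ℕ → List ℕ → ℕ → ℕ
    grow zero as zero = closeAll as
    grow zero as (suc c) = 0
    grow (suc n) as c = growOpen n as c + bump (λ xs → grow n xs c) as

    growOpen : ℕ → List ℕ → ℕ → ℕ
    growOpen n as zero = 0
    growOpen n as (suc c) = grow n (as ++ 1 ∷ []) c

  bump-cong : ∀ {g h : List ℕ → ℕ} → (∀ xs → g xs ≡ h xs) → ∀ as → bump g as ≡ bump h as
  bump-cong e [] = refl
  bump-cong e (a ∷ as) = cong₂ _+_ (e (suc a ∷ as)) (bump-cong (λ xs → e (a ∷ xs)) as)

  bump-*ˡ : ∀ c (h : List ℕ → ℕ) as → bump (λ xs → c * h xs) as ≡ c * bump h as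
  bump-*ˡ c h [] = sym (*-zeroʳ c)
  bump-*ˡ c h (a ∷ as) = trans (cong (c * h (suc a ∷ as) +_) (bump-*ˡ c (λ xs → h (a ∷ xs)) as)) (sym (*-distribˡ-+ c _ _))

  bump-*ʳ : ∀ c (h : List ℕ → ℕ) as → bump (λ xs → h xs * c) as ≡ bump h as * c
  bump-*ʳ c h as = trans (bump-cong (λ xs → *-comm (h xs) c) as) (trans (bump-*ˡ c h as) (*-comm c (bump h as)))

  bump-+ : ∀ (g h : List ℕ → ℕ) as → bump (λ xs → g xs + h xs) as ≡ bump g as + bump h as
  bump-+ g h [] = refl
  bump-+ g h (a ∷ as) rewrite bump-+ (λ xs → g (a ∷ xs)) (λ xs → h (a ∷ xs)) as =
    +-interchange (g (suc a ∷ as)) (h (suc a ∷ as)) _ _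

  bump-++ : ∀ (g : List ℕ → ℕ) xs ys → bump g (xs ++ ys) ≡ bump (λ zs → g (zs ++ ys)) xs + bump (λ zs → g (xs ++ zs)) ys
  bump-++ g [] ys = refl
  bump-++ g (x ∷ xs) ys rewrite bump-++ (λ zs → g (x ∷ zs)) xs ys = sym (+-assoc (g (suc x ∷ xs ++ ys)) _ _)

  sumTo-bump : ∀ n (h : ℕ → List ℕ → ℕ) as → sumTo n (λ a → bump (h a) as) ≡ bump (λ xs → sumTo n (λ a → h a xs)) as
  sumTo-bump zero h [] = refl
  sumTo-bump zero h (a ∷ as) = sumTo-bump zero (λ i xs → h i (a ∷ xs)) as
  sumTo-bump (suc n) h as rewrite sumTo-bump n (h ∘ suc) as = sym (bump-+ (h 0) (λ xs → sumTo n (λ a → h (suc a) xs)) as)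

  bump-↭ : ∀ (g : List ℕ → ℕ) → (∀ {us vs} → us ↭ vs → g us ≡ g vs) → ∀ {xs ys} → xs ↭ ys → bump g xs ≡ bump g ys
  bump-↭ g g-sym Perm.refl = refl
  bump-↭ g g-sym (Perm.prep x p) =
    cong₂ _+_ (g-sym (Perm.prep (suc x) p)) (bump-↭ (λ zs → g (x ∷ zs)) (λ q → g-sym (Perm.prep x q)) p)
  bump-↭ g g-sym {x ∷ y ∷ xs} {.y ∷ .x ∷ ys} (Perm.swap x y p) = begin
    g (suc x ∷ y ∷ xs) + (g (x ∷ suc y ∷ xs) + bump (λ zs → g (x ∷ y ∷ zs)) xs)
      ≡⟨ cong₂ (λ a b → a + (b + bump (λ zs → g (x ∷ y ∷ zs)) xs)) (g-sym (Perm.swap (suc x) y p)) (g-sym (Perm.swap x (suc y) p)) ⟩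
    g (y ∷ suc x ∷ ys) + (g (suc y ∷ x ∷ ys) + bump (λ zs → g (x ∷ y ∷ zs)) xs)
      ≡⟨ cong (λ z → g (y ∷ suc x ∷ ys) + (g (suc y ∷ x ∷ ys) + z)) rest ⟩
    g (y ∷ suc x ∷ ys) + (g (suc y ∷ x ∷ ys) + bump (λ zs → g (y ∷ x ∷ zs)) ys)
      ≡⟨ +-left-comm (g (y ∷ suc x ∷ ys)) (g (suc y ∷ x ∷ ys)) _ ⟩
    g (suc y ∷ x ∷ ys) + (g (y ∷ suc x ∷ ys) + bump (λ zs → g (y ∷ x ∷ zs)) ys) ∎
    where
    open ≡-Reasoning
    rest : bump (λ zs → g (x ∷ y ∷ zs)) xs ≡ bump (λ zs → g (y ∷ x ∷ zs)) ys
    rest = trans (bump-↭ (λ zs → g (x ∷ y ∷ zs)) (λ q → g-sym (Perm.prep x (Perm.prep y q))) p)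
                 (bump-cong (λ zs → g-sym (Perm.swap x y Perm.refl)) ys)
  bump-↭ g g-sym (Perm.trans p q) = trans (bump-↭ g g-sym p) (bump-↭ g g-sym q)

  grow-↭ : ∀ M c {xs ys} → xs ↭ ys → grow M xs c ≡ grow M ys c
  grow-↭ zero zero p = product-↭ (Perm.map⁺ (λ a → fill a 0) p)
  grow-↭ zero (suc c) p = refl
  grow-↭ (suc M) c p = cong₂ _+_ (open-↭ c) (bump-↭ (λ zs → grow M zs c) (grow-↭ M c) p)
    where
    open-↭ : ∀ c → growOpen M _ c ≡ growOpen M _ c
    open-↭ zero = refl
    open-↭ (suc c) = grow-↭ M c (Perm.++⁺ʳ (1 ∷ []) p)

  grow-move-new : ∀ M c as₁ as₂ → grow M ((as₁ ++ 1 ∷ []) ++ as₂) c ≡ grow M ((as₁ ++ as₂) ++ 1 ∷ []) c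
  grow-move-new M c as₁ as₂ = begin
    grow M ((as₁ ++ 1 ∷ []) ++ as₂) c   ≡⟨ cong (λ z → grow M z c) (++-assoc as₁ (1 ∷ []) as₂) ⟩
    grow M (as₁ ++ (1 ∷ []) ++ as₂) c   ≡⟨ grow-↭ M c (Perm.++⁺ˡ as₁ (Perm.++-comm (1 ∷ []) as₂)) ⟩
    grow M (as₁ ++ as₂ ++ 1 ∷ []) c     ≡⟨ cong (λ z → grow M z c) (sym (++-assoc as₁ as₂ (1 ∷ []))) ⟩
    grow M ((as₁ ++ as₂) ++ 1 ∷ []) c ∎
    where open ≡-Reasoning

  binConv-bumpʳ : ∀ M (G : ℕ → ℕ) (H : ℕ → List ℕ → ℕ) as →
    binConv M (λ i j → G i * bump (H j) as) ≡ bump (λ xs → binConv M (λ i j → G i * H j xs)) as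
  binConv-bumpʳ M G H as =
    trans (sumTo-cong′ (suc M) (λ a → trans (cong ((M C a) *_) (sym (bump-*ˡ (G a) (H (M ∸ a)) as)))
                                             (sym (bump-*ˡ (M C a) _ as))))
          (sumTo-bump (suc M) (λ a xs → (M C a) * (G a * H (M ∸ a) xs)) as)

  binConv-bumpˡ : ∀ M (G : ℕ → List ℕ → ℕ) (H : ℕ → ℕ) as →
    binConv M (λ i j → bump (G i) as * H j) ≡ bump (λ xs → binConv M (λ i j → G i xs * H j)) as
  binConv-bumpˡ M G H as =
    trans (sumTo-cong′ (suc M) (λ a → trans (cong ((M C a) *_) (sym (bump-*ʳ (H (M ∸ a)) (G a) as)))
                                             (sym (bump-*ˡ (M C a) _ as))))
          (sumTo-bump (suc M) (λ a xs → (M C a) * (G a xs * H (M ∸ a))) as)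

  -- The convolution identity for grow: distributing M elements between two
  -- independent growth processes (with c₁ and c₂ lists to open) amounts to one
  -- process on the union, up to choosing which c₁ of the c₁+c₂ new lists belong to
  -- the first process.
  Convolution : ℕ → Set
  Convolution M = ∀ as₁ c₁ as₂ c₂ →
    binConv M (λ i j → grow i as₁ c₁ * grow j as₂ c₂) ≡ ((c₁ + c₂) C c₁) * grow M (as₁ ++ as₂) (c₁ + c₂)

  -- The "open a new list" terms of the Leibniz expansion combine by Pascal's rule.
  convolution-open : ∀ M → Convolution M → ∀ as₁ c₁ as₂ c₂ →
    binConv M (λ i j → grow i as₁ c₁ * growOpen j as₂ c₂) + binConv M (λ i j → growOpen i as₁ c₁ * grow j as₂ c₂)
      ≡ ((c₁ + c₂) C c₁) * growOpen M (as₁ ++ as₂) (c₁ + c₂)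
  convolution-open M IH as₁ zero as₂ zero =
    cong₂ _+_ (binConv-zero M _ (λ i j → *-zeroʳ (grow i as₁ 0))) (binConv-zero M _ (λ i j → refl))
  convolution-open M IH as₁ zero as₂ (suc c₂) =
    trans (cong₂ _+_ (IH as₁ 0 (as₂ ++ 1 ∷ []) c₂) (binConv-zero M _ (λ i j → refl)))
          (trans (+-identityʳ _) (cong (λ z → (c₂ C 0) * grow M z c₂) (sym (++-assoc as₁ as₂ (1 ∷ [])))))
  convolution-open M IH as₁ (suc c₁) as₂ zero = begin
    binConv M (λ i j → grow i as₁ (suc c₁) * 0) + binConv M (λ i j → grow i (as₁ ++ 1 ∷ []) c₁ * grow j as₂ 0)
      ≡⟨ cong₂ _+_ (binConv-zero M _ (λ i j → *-zeroʳ (grow i as₁ (suc c₁)))) (IH (as₁ ++ 1 ∷ []) c₁ as₂ 0) ⟩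
    ((c₁ + 0) C c₁) * grow M ((as₁ ++ 1 ∷ []) ++ as₂) (c₁ + 0)
      ≡⟨ cong₂ _*_ (trans (cong (_C c₁) (+-identityʳ c₁)) (trans (nCn≡1 c₁) (sym (nCn≡1 (suc c₁))))) (grow-move-new M (c₁ + 0) as₁ as₂) ⟩
    (suc c₁ C suc c₁) * grow M ((as₁ ++ as₂) ++ 1 ∷ []) (c₁ + 0)
      ≡⟨ cong (λ z → (z C suc c₁) * grow M ((as₁ ++ as₂) ++ 1 ∷ []) (c₁ + 0)) (sym (cong suc (+-identityʳ c₁))) ⟩
    (suc (c₁ + 0) C suc c₁) * grow M ((as₁ ++ as₂) ++ 1 ∷ []) (c₁ + 0) ∎
    where open ≡-Reasoning
  convolution-open M IH as₁ (suc c₁) as₂ (suc c₂) = begin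
    binConv M (λ i j → grow i as₁ (suc c₁) * grow j (as₂ ++ 1 ∷ []) c₂) + binConv M (λ i j → grow i (as₁ ++ 1 ∷ []) c₁ * grow j as₂ (suc c₂))
      ≡⟨ cong₂ _+_ (IH as₁ (suc c₁) (as₂ ++ 1 ∷ []) c₂) (IH (as₁ ++ 1 ∷ []) c₁ as₂ (suc c₂)) ⟩
    (suc (c₁ + c₂) C suc c₁) * grow M (as₁ ++ (as₂ ++ 1 ∷ [])) (suc (c₁ + c₂)) + ((c₁ + suc c₂) C c₁) * grow M ((as₁ ++ 1 ∷ []) ++ as₂) (c₁ + suc c₂)
      ≡⟨ cong (λ z → (suc (c₁ + c₂) C suc c₁) * grow M (as₁ ++ (as₂ ++ 1 ∷ [])) (suc (c₁ + c₂)) + (z C c₁) * grow M ((as₁ ++ 1 ∷ []) ++ as₂) z) (+-suc c₁ c₂) ⟩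
    (suc t C suc c₁) * grow M (as₁ ++ (as₂ ++ 1 ∷ [])) (suc t) + (suc t C c₁) * grow M ((as₁ ++ 1 ∷ []) ++ as₂) (suc t)
      ≡⟨ cong₂ (λ x y → (suc t C suc c₁) * x + (suc t C c₁) * y)
               (cong (λ z → grow M z (suc t)) (sym (++-assoc as₁ as₂ (1 ∷ [])))) (grow-move-new M (suc t) as₁ as₂) ⟩
    (suc t C suc c₁) * W + (suc t C c₁) * W
      ≡⟨ sym (*-distribʳ-+ W (suc t C suc c₁) (suc t C c₁)) ⟩
    ((suc t C suc c₁) + (suc t C c₁)) * W
      ≡⟨ cong (_* W) (trans (+-comm (suc t C suc c₁) (suc t C c₁)) (nCk+nC[k+1]≡[n+1]C[k+1] (suc t) c₁)) ⟩
    (suc (suc t) C suc c₁) * W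
      ≡⟨ cong (λ z → (suc z C suc c₁) * grow M ((as₁ ++ as₂) ++ 1 ∷ []) z) (sym (+-suc c₁ c₂)) ⟩
    (suc (c₁ + suc c₂) C suc c₁) * grow M ((as₁ ++ as₂) ++ 1 ∷ []) (c₁ + suc c₂) ∎
    where
    open ≡-Reasoning
    t : ℕ
    t = c₁ + c₂
    W : ℕ
    W = grow M ((as₁ ++ as₂) ++ 1 ∷ []) (suc t)

  -- Induction on M: split off the last element by the Leibniz rule; the terms where
  -- it opens a list are handled above, those where it joins a list by induction.
  convolution : ∀ M → Convolution M
  convolution zero as₁ zero as₂ zero = trans (+-identityʳ _) (cong (1 *_) (sym (closeAll-++ as₁ as₂)))
    where
    closeAll-++ : ∀ xs ys → closeAll (xs ++ ys) ≡ closeAll xs * closeAll ys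
    closeAll-++ xs ys = trans (cong product (map-++ (λ a → fill a 0) xs ys)) (product-++ (map (λ a → fill a 0) xs) _)
  convolution zero as₁ zero as₂ (suc c₂) = trans (+-identityʳ _) (trans (cong (1 *_) (*-zeroʳ (closeAll as₁))) (sym (*-zeroʳ (suc c₂ C 0))))
  convolution zero as₁ (suc c₁) as₂ c₂ = sym (*-zeroʳ ((suc c₁ + c₂) C suc c₁))
  convolution (suc M) as₁ c₁ as₂ c₂ = begin
    binConv (suc M) (λ i j → grow i as₁ c₁ * grow j as₂ c₂)
      ≡⟨ binConv-suc M (λ i j → grow i as₁ c₁ * grow j as₂ c₂) ⟩
    binConv M (λ i j → grow i as₁ c₁ * (growOpen j as₂ c₂ + bump (λ xs → grow j xs c₂) as₂))
      + binConv M (λ i j → (growOpen i as₁ c₁ + bump (λ xs → grow i xs c₁) as₁) * grow j as₂ c₂)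
      ≡⟨ cong₂ _+_ (trans (binConv-cong M (λ i j → *-distribˡ-+ (grow i as₁ c₁) (growOpen j as₂ c₂) (bump (λ xs → grow j xs c₂) as₂)))
                          (binConv-+ M (λ i j → grow i as₁ c₁ * growOpen j as₂ c₂) (λ i j → grow i as₁ c₁ * bump (λ xs → grow j xs c₂) as₂)))
                   (trans (binConv-cong M (λ i j → *-distribʳ-+ (grow j as₂ c₂) (growOpen i as₁ c₁) (bump (λ xs → grow i xs c₁) as₁)))
                          (binConv-+ M (λ i j → growOpen i as₁ c₁ * grow j as₂ c₂) (λ i j → bump (λ xs → grow i xs c₁) as₁ * grow j as₂ c₂))) ⟩
    (O₂ + J₂) + (O₁ + J₁)
      ≡⟨ +-interchange O₂ J₂ O₁ J₁ ⟩
    (O₂ + O₁) + (J₂ + J₁)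
      ≡⟨ cong₂ _+_ (convolution-open M (convolution M) as₁ c₁ as₂ c₂) (cong₂ _+_ J₂≡ J₁≡) ⟩
    C′ * growOpen M (as₁ ++ as₂) (c₁ + c₂) + (C′ * bump (λ xs → grow M (as₁ ++ xs) (c₁ + c₂)) as₂ + C′ * bump (λ xs → grow M (xs ++ as₂) (c₁ + c₂)) as₁)
      ≡⟨ cong (C′ * growOpen M (as₁ ++ as₂) (c₁ + c₂) +_) joins ⟩
    C′ * growOpen M (as₁ ++ as₂) (c₁ + c₂) + C′ * bump (λ xs → grow M xs (c₁ + c₂)) (as₁ ++ as₂)
      ≡⟨ sym (*-distribˡ-+ C′ _ _) ⟩
    C′ * grow (suc M) (as₁ ++ as₂) (c₁ + c₂) ∎
    where
    open ≡-Reasoning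
    C′ O₂ J₂ O₁ J₁ : ℕ
    C′ = (c₁ + c₂) C c₁
    O₂ = binConv M (λ i j → grow i as₁ c₁ * growOpen j as₂ c₂)
    J₂ = binConv M (λ i j → grow i as₁ c₁ * bump (λ xs → grow j xs c₂) as₂)
    O₁ = binConv M (λ i j → growOpen i as₁ c₁ * grow j as₂ c₂)
    J₁ = binConv M (λ i j → bump (λ xs → grow i xs c₁) as₁ * grow j as₂ c₂)
    J₂≡ : J₂ ≡ C′ * bump (λ xs → grow M (as₁ ++ xs) (c₁ + c₂)) as₂
    J₂≡ = trans (binConv-bumpʳ M (λ i → grow i as₁ c₁) (λ j xs → grow j xs c₂) as₂)
                (trans (bump-cong (λ xs → convolution M as₁ c₁ xs c₂) as₂) (bump-*ˡ C′ _ as₂))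
    J₁≡ : J₁ ≡ C′ * bump (λ xs → grow M (xs ++ as₂) (c₁ + c₂)) as₁
    J₁≡ = trans (binConv-bumpˡ M (λ i xs → grow i xs c₁) (λ j → grow j as₂ c₂) as₁)
                (trans (bump-cong (λ xs → convolution M xs c₁ as₂ c₂) as₁) (bump-*ˡ C′ _ as₁))
    joins : C′ * bump (λ xs → grow M (as₁ ++ xs) (c₁ + c₂)) as₂ + C′ * bump (λ xs → grow M (xs ++ as₂) (c₁ + c₂)) as₁
            ≡ C′ * bump (λ xs → grow M xs (c₁ + c₂)) (as₁ ++ as₂)
    joins = trans (sym (*-distribˡ-+ C′ _ _))
                  (cong (C′ *_) (trans (+-comm (bump (λ xs → grow M (as₁ ++ xs) (c₁ + c₂)) as₂) _) (sym (bump-++ (λ xs → grow M xs (c₁ + c₂)) as₁ as₂))))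

  -- grow vanishes when there are too few elements to give every list s elements:
  -- the final lists have n + Σ as elements in total and there are |as| + c of them.
  grow-vanish : ∀ n as c → n + sumL as < s * (length as + c) → grow n as c ≡ 0
  grow-vanish zero as zero few = closeAll-vanish as (subst (λ z → sumL as < s * z) (+-identityʳ (length as)) few)
    where
    fill-vanish : ∀ a ℓ → a + ℓ < s → fill a ℓ ≡ 0
    fill-vanish zero ℓ short = cong 𝟙 (≤ᵇ-false short)
    fill-vanish (suc a) ℓ short = trans (cong (suc ℓ *_) (fill-vanish a (suc ℓ) (subst (_< s) (sym (+-suc a ℓ)) short)))
                                        (*-zeroʳ (suc ℓ))
    -- some list is shorter than s
    closeAll-vanish : ∀ as → sumL as < s * length as → closeAll as ≡ 0
    closeAll-vanish [] few = ⊥-elim (n≮0 (subst (0 <_) (*-zeroʳ s) few))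
    closeAll-vanish (a ∷ as) few with a <? s
    ... | yes a<s = cong (_* closeAll as) (fill-vanish a 0 (subst (_< s) (sym (+-identityʳ a)) a<s))
    ... | no a≮s = trans (cong (fill a 0 *_) (closeAll-vanish as few′)) (*-zeroʳ (fill a 0))
      where
      few′ : sumL as < s * length as
      few′ = +-cancelˡ-< s (sumL as) (s * length as)
               (≤-<-trans (+-monoˡ-≤ (sumL as) (≮⇒≥ a≮s)) (subst (a + sumL as <_) (*-suc s (length as)) few))
  grow-vanish zero as (suc c) few = refl
  grow-vanish (suc n) as c few = cong₂ _+_ (open-vanish c few) (bump-vanish (λ xs → grow n xs c) as join-vanish)
    where
    bump-vanish : ∀ (g : List ℕ → ℕ) as → (∀ xs → sumL xs ≡ suc (sumL as) → length xs ≡ length as → g xs ≡ 0) → bump g as ≡ 0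
    bump-vanish g [] h = refl
    bump-vanish g (a ∷ as) h = cong₂ _+_ (h (suc a ∷ as) refl refl)
      (bump-vanish (λ xs → g (a ∷ xs)) as (λ xs σ len → h (a ∷ xs) (trans (cong (a +_) σ) (+-suc a (sumL as))) (cong suc len)))
    join-vanish : ∀ xs → sumL xs ≡ suc (sumL as) → length xs ≡ length as → grow n xs c ≡ 0
    join-vanish xs σ len = grow-vanish n xs c
      (subst₂ (λ x y → n + x < s * (y + c)) (sym σ) (sym len) (subst (_< s * (length as + c)) (sym (+-suc n (sumL as))) few))
    open-vanish : ∀ c → suc n + sumL as < s * (length as + c) → growOpen n as c ≡ 0
    open-vanish zero _ = refl
    open-vanish (suc c) few′ = grow-vanish n (as ++ 1 ∷ []) c (subst₂ (λ x y → x < s * y) σ len few′)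
      where
      σ : suc n + sumL as ≡ n + sumL (as ++ 1 ∷ [])
      σ = trans (sym (+-suc n (sumL as))) (cong (n +_) (trans (+-comm 1 (sumL as)) (sym (sum-++ as (1 ∷ [])))))
      len : length as + suc c ≡ length (as ++ 1 ∷ []) + c
      len = trans (+-suc (length as) c) (cong (_+ c) (trans (+-comm 1 (length as)) (sym (length-++ as))))

  prodGrow : ∀ {p} → Vec ℕ p → Vec ℕ p → Vec ℕ p → ℕ
  prodGrow [] [] [] = 1
  prodGrow (k ∷ ks) (r ∷ rs) (l ∷ ls) = grow l (replicate r 1) k * prodGrow ks rs ls

  -- Terms violating l ≥ s k + (s−1) r vanish: then l + r < s (r + k).
  inadmissible-vanish : ∀ {p} (ks rs ls : Vec ℕ p) → admissible s ks rs ls ≡ false → prodGrow ks rs ls ≡ 0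
  inadmissible-vanish [] [] [] ()
  inadmissible-vanish (k ∷ ks) (r ∷ rs) (l ∷ ls) bad with s * k + (s ∸ 1) * r ≤ᵇ l in eq
  ... | true = trans (cong (grow l (replicate r 1) k *_) (inadmissible-vanish ks rs ls bad)) (*-zeroʳ (grow l (replicate r 1) k))
  ... | false = cong (_* prodGrow ks rs ls) (grow-vanish l (replicate r 1) k
          (subst₂ (λ x y → l + x < s * (y + k)) (sym (sum-replicate-1 r)) (sym (length-replicate r)) (too-few s l<bound)))
    where
    l<bound : l < s * k + (s ∸ 1) * r
    l<bound = ≰⇒> (λ l≥bound → subst T eq (≤⇒≤ᵇ l≥bound))
    too-few : ∀ s → l < s * k + (s ∸ 1) * r → l + r < s * (r + k)
    too-few zero l<0 = ⊥-elim (n≮0 l<0)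
    too-few (suc s′) l<bound′ = subst (l + r <_) (expand s′ k r) (+-monoˡ-< r l<bound′)
      where
      expand : ∀ s′ k r → suc s′ * k + s′ * r + r ≡ suc s′ * (r + k)
      expand = solve-∀
    sum-replicate-1 : ∀ r → sumL (replicate r 1) ≡ r
    sum-replicate-1 zero = refl
    sum-replicate-1 (suc r) = cong suc (sum-replicate-1 r)

  -- Iterating the convolution identity over the p parts: the multinomial form.
  multinomial-convolution : ∀ p n (ks rs : Vec ℕ p) →
    ∑ (weakComps p n) (λ ls → multinomial ls * prodGrow ks rs ls)
      ≡ multinomial ks * grow n (replicate (Vec.sum rs) 1) (Vec.sum ks)
  multinomial-convolution zero zero [] [] = refl
  multinomial-convolution zero (suc n) [] [] = refl
  multinomial-convolution (suc p) n (k ∷ ks) (r ∷ rs) = begin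
    ∑ (concatMap (λ a → map (a ∷_) (weakComps p (n ∸ a))) (upTo (suc n))) term
      ≡⟨ ∑-concatMap (upTo (suc n)) (λ a → map (a ∷_) (weakComps p (n ∸ a))) term ⟩
    ∑ (upTo (suc n)) (λ a → ∑ (map (a ∷_) (weakComps p (n ∸ a))) term)
      ≡⟨ ∑-cong′ (upTo (suc n)) (λ a → ∑-map (weakComps p (n ∸ a)) (a ∷_) term) ⟩
    ∑ (upTo (suc n)) (λ a → ∑ (weakComps p (n ∸ a)) (λ ls → term (a ∷ ls)))
      ≡⟨ ∑-upTo (suc n) _ ⟩
    sumTo (suc n) (λ a → ∑ (weakComps p (n ∸ a)) (λ ls → term (a ∷ ls)))
      ≡⟨ sumTo-cong (suc n) first-part ⟩
    sumTo (suc n) (λ a → m * ((n C a) * (grow a R k * grow (n ∸ a) R′ K′)))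
      ≡⟨ sumTo-*ˡ (suc n) m (λ a → (n C a) * (grow a R k * grow (n ∸ a) R′ K′)) ⟩
    m * binConv n (λ i j → grow i R k * grow j R′ K′)
      ≡⟨ cong (m *_) (convolution n R k R′ K′) ⟩
    m * (((k + K′) C k) * grow n (R ++ R′) (k + K′))
      ≡⟨ cong (λ z → m * (((k + K′) C k) * grow n z (k + K′))) (sym (replicate-++ r (Vec.sum rs))) ⟩
    m * (((k + K′) C k) * grow n (replicate (r + Vec.sum rs) 1) (k + K′))
      ≡⟨ reassoc m ((k + K′) C k) _ ⟩
    ((k + K′) C k) * m * grow n (replicate (r + Vec.sum rs) 1) (k + K′) ∎
    where
    open ≡-Reasoning
    term : Vec ℕ (suc p) → ℕ
    term ls = multinomial ls * prodGrow (k ∷ ks) (r ∷ rs) ls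
    m K′ : ℕ
    m = multinomial ks
    K′ = Vec.sum ks
    R R′ : List ℕ
    R = replicate r 1
    R′ = replicate (Vec.sum rs) 1
    reassoc : ∀ a b c → a * (b * c) ≡ b * a * c
    reassoc = solve-∀
    replicate-++ : ∀ a b → replicate (a + b) 1 ≡ replicate a 1 ++ replicate b 1
    replicate-++ zero b = refl
    replicate-++ (suc a) b = cong (1 ∷_) (replicate-++ a b)
    first-part : ∀ a → a < suc n → ∑ (weakComps p (n ∸ a)) (λ ls → term (a ∷ ls)) ≡ m * ((n C a) * (grow a R k * grow (n ∸ a) R′ K′))
    first-part a a≤n = begin
      ∑ (weakComps p (n ∸ a)) (λ ls → term (a ∷ ls))
        ≡⟨ ∑-cong (weakComps p (n ∸ a)) (All.map (λ {ls} σ → trans (cong (λ z → (z C a) * multinomial ls * (grow a R k * prodGrow ks rs ls))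
                                                                          (trans (cong (a +_) σ) (m+[n∸m]≡n (s≤s⁻¹ a≤n))))
                                                                    (shuffle₁ (n C a) (multinomial ls) (grow a R k) (prodGrow ks rs ls)))
                                                 (weakComps-sum p (n ∸ a))) ⟩
      ∑ (weakComps p (n ∸ a)) (λ ls → (n C a) * grow a R k * (multinomial ls * prodGrow ks rs ls))
        ≡⟨ ∑-*ˡ (weakComps p (n ∸ a)) ((n C a) * grow a R k) _ ⟩
      (n C a) * grow a R k * ∑ (weakComps p (n ∸ a)) (λ ls → multinomial ls * prodGrow ks rs ls)
        ≡⟨ cong ((n C a) * grow a R k *_) (multinomial-convolution p (n ∸ a) ks rs) ⟩
      (n C a) * grow a R k * (m * grow (n ∸ a) R′ K′)
        ≡⟨ shuffle₂ (n C a) (grow a R k) m (grow (n ∸ a) R′ K′) ⟩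
      m * ((n C a) * (grow a R k * grow (n ∸ a) R′ K′)) ∎
      where
      shuffle₁ : ∀ x y z w → x * y * (z * w) ≡ x * z * (y * w)
      shuffle₁ = solve-∀
      shuffle₂ : ∀ x z y w → x * z * (y * w) ≡ y * (x * (z * w))
      shuffle₂ = solve-∀

-- From the enumeration L of Defs to the growth recursion

module Enumeration (s r : ℕ) where
  open Growth s

  okBlock : List ℕ → Bool
  okBlock b = (s ≤ᵇ length b) ∧ (countLe r b ≤ᵇ 1)

  above : Maybe ℕ → ℕ → Bool
  above nothing _ = true
  above (just b) x = b <ᵇ x

  validFrom : Maybe ℕ → List (List ℕ) → Bool
  validFrom bd [] = true
  validFrom bd (b ∷ bs) = (okBlock b ∧ above bd (minL b)) ∧ validFrom (just (minL b)) bs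

  valid≡validFrom : ∀ bs → valid s r bs ≡ validFrom nothing bs
  valid≡validFrom [] = refl
  valid≡validFrom (b ∷ bs) = trans (cong (λ z → (sz b ∧ and (map sz bs)) ∧ (ct b ∧ and (map ct bs)) ∧ z) (increasing-∷ b bs))
                                  (sym (trans (cong (((sz b ∧ ct b) ∧ true) ∧_) (validFrom-just (minL b) bs)) (∧-transpose (sz b) (ct b) true _ _ _)))
    where
    sz ct : List ℕ → Bool
    sz b = s ≤ᵇ length b
    ct b = countLe r b ≤ᵇ 1
    increasingAfter : ℕ → List (List ℕ) → Bool
    increasingAfter x [] = true
    increasingAfter x (c ∷ cs) = (x <ᵇ minL c) ∧ increasingMins (c ∷ cs)
    increasing-∷ : ∀ b bs → increasingMins (b ∷ bs) ≡ increasingAfter (minL b) bs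
    increasing-∷ b [] = refl
    increasing-∷ b (c ∷ cs) = refl
    ∧-transpose : ∀ a b l x y z → ((a ∧ b) ∧ l) ∧ (x ∧ y ∧ z) ≡ (a ∧ x) ∧ (b ∧ y) ∧ (l ∧ z)
    ∧-transpose true true true x y z = refl
    ∧-transpose true true false true true z = refl
    ∧-transpose true true false true false z = refl
    ∧-transpose true true false false y z = refl
    ∧-transpose true false l true y z = refl
    ∧-transpose true false l false y z = refl
    ∧-transpose false b l x y z = refl
    validFrom-just : ∀ x bs → validFrom (just x) bs ≡ (and (map sz bs) ∧ and (map ct bs) ∧ increasingAfter x bs)
    validFrom-just x [] = refl
    validFrom-just x (c ∷ cs) =
      trans (cong (((sz c ∧ ct c) ∧ (x <ᵇ minL c)) ∧_) (validFrom-just (minL c) cs))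
            (trans (∧-transpose (sz c) (ct c) (x <ᵇ minL c) (and (map sz cs)) (and (map ct cs)) (increasingAfter (minL c) cs))
                   (cong (λ z → (sz c ∧ and (map sz cs)) ∧ (ct c ∧ and (map ct cs)) ∧ ((x <ᵇ minL c) ∧ z)) (sym (increasing-∷ c cs))))

  firstBlock : Maybe ℕ → List ℕ → ℕ
  firstBlock bd [] = 0
  firstBlock bd (x ∷ xs) = 𝟙 (okBlock (x ∷ xs) ∧ above bd (minL (x ∷ xs)))

  closedCount : Maybe ℕ → ℕ → List ℕ → ℕ
  closedCount bd zero [] = 1
  closedCount bd zero (_ ∷ _) = 0
  closedCount bd (suc k) π = sumSplits π (λ u v → firstBlock bd u * closedCount (just (minL u)) k v)

  count-splits : ∀ k bd π → length (filterᵇ (validFrom bd) (splits k π)) ≡ closedCount bd k π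
  count-splits zero bd [] = refl
  count-splits zero bd (x ∷ xs) = refl
  count-splits (suc k) bd [] = refl
  count-splits (suc k) bd (x ∷ xs) = begin
    length (filterᵇ (validFrom bd) (splits (suc k) π))
      ≡⟨ length-filter-concatMap (validFrom bd) (λ i → map (take i π ∷_) (splits k (drop i π))) (map suc (upTo (length π))) ⟩
    ∑ (map suc (upTo (length π))) (λ i → length (filterᵇ (validFrom bd) (map (take i π ∷_) (splits k (drop i π)))))
      ≡⟨ ∑-map (upTo (length π)) suc (λ i → length (filterᵇ (validFrom bd) (map (take i π ∷_) (splits k (drop i π))))) ⟩
    ∑ (upTo (length π)) (λ i → length (filterᵇ (validFrom bd) (map (take (suc i) π ∷_) (splits k (drop (suc i) π)))))
      ≡⟨ ∑-cong′ (upTo (length π)) chunk ⟩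
    ∑ (upTo (length π)) (λ i → G (take (suc i) π) (drop (suc i) π))
      ≡⟨ ∑-upTo (length π) (λ i → G (take (suc i) π) (drop (suc i) π)) ⟩
    sumTo (length π) (λ i → G (take (suc i) π) (drop (suc i) π))
      ≡⟨ sym (sumSplits-take-drop π G) ⟩
    closedCount bd (suc k) π ∎
    where
    open ≡-Reasoning
    π : List ℕ
    π = x ∷ xs
    G : List ℕ → List ℕ → ℕ
    G u v = firstBlock bd u * closedCount (just (minL u)) k v
    chunk : ∀ i → length (filterᵇ (validFrom bd) (map (take (suc i) π ∷_) (splits k (drop (suc i) π))))
                  ≡ G (take (suc i) π) (drop (suc i) π)
    chunk i = trans (length-filter-map-∧ (validFrom bd) (c ∷_) (okBlock c ∧ above bd (minL c)) (validFrom (just (minL c))) (λ _ → refl) (splits k (drop (suc i) π)))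
                    (cong (firstBlock bd c *_) (count-splits k _ (drop (suc i) π)))
      where
      c : List ℕ
      c = x ∷ take i xs

  L≡∑closedCount : ∀ N K → L s r N K ≡ ∑ (perms (oneTo N)) (closedCount nothing K)
  L≡∑closedCount N K =
    trans (length-filter-concatMap (valid s r) (splits K) (perms (oneTo N)))
          (∑-cong′ (perms (oneTo N)) (λ π → trans (length-filter-cong (valid s r) (validFrom nothing) valid≡validFrom (splits K π))
                                                  (count-splits K nothing π)))

  firstBlock-below : ∀ {b} u → (b <ᵇ minL u) ≡ false → firstBlock (just b) u ≡ 0
  firstBlock-below [] _ = refl
  firstBlock-below (x ∷ xs) e = cong 𝟙 (trans (cong (okBlock (x ∷ xs) ∧_) e) (∧-zeroʳ _))

  closedCount-vanish : ∀ k b v {m} → m ∈ v → m < b → closedCount (just b) k v ≡ 0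
  closedCount-vanish zero b (x ∷ xs) _ _ = refl
  closedCount-vanish (suc k) b v {m} m∈v m<b = trans (sumSplits-cong v vanish) (sumSplits-zero v)
    where
    vanish : ∀ u v′ → u ++ v′ ≡ v → firstBlock (just b) u * closedCount (just (minL u)) k v′ ≡ 0
    vanish [] v′ _ = refl
    vanish (x ∷ xs) v′ e with Any.++⁻ (x ∷ xs) (subst (m ∈_) (sym e) m∈v)
    ... | inj₁ m∈u = cong (_* closedCount (just (minL (x ∷ xs))) k v′)
                          (firstBlock-below (x ∷ xs) (<ᵇ-false (≤-trans (minL-ub (x ∷ xs) m∈u) (<⇒≤ m<b))))
    ... | inj₂ m∈v′ with b <? minL (x ∷ xs)
    ...   | no b≮min = cong (_* closedCount (just (minL (x ∷ xs))) k v′) (firstBlock-below (x ∷ xs) (<ᵇ-false (≮⇒≥ b≮min)))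
    ...   | yes b<min = trans (cong (firstBlock (just b) (x ∷ xs) *_) (closedCount-vanish k _ v′ m∈v′ (<-trans m<b b<min)))
                              (*-zeroʳ (firstBlock (just b) (x ∷ xs)))

  closedCount-unbounded : ∀ k b v → All (b <_) v → closedCount (just b) k v ≡ closedCount nothing k v
  closedCount-unbounded zero b [] _ = refl
  closedCount-unbounded zero b (x ∷ xs) _ = refl
  closedCount-unbounded (suc k) b v b<v = sumSplits-cong v same
    where
    same : ∀ u v′ → u ++ v′ ≡ v → firstBlock (just b) u * closedCount (just (minL u)) k v′ ≡ firstBlock nothing u * closedCount (just (minL u)) k v′
    same [] v′ e = refl
    same (x ∷ xs) v′ e = cong (λ z → 𝟙 (okBlock (x ∷ xs) ∧ z) * closedCount (just (minL (x ∷ xs))) k v′)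
      (<ᵇ-true (minL-lb (x ∷ xs) (λ ()) (proj₁ (All.++⁻ (x ∷ xs) (subst (All (b <_)) (sym e) b<v)))))

  -- A partial construction after the smallest elements have been removed from the
  -- permutation: for each open list, in order of creation, the number of removed
  -- elements belonging to it and how many of them are special.
  OpenLists : Set
  OpenLists = List (ℕ × ℕ)

  -- Weight of an open list with a removed elements (f of them special) whose
  -- remaining elements form u: the removed elements can be put back in fill a |u|
  -- ways, and the list must not contain two special elements.
  openWeight : ℕ → ℕ → List ℕ → ℕ
  openWeight a f u = fill a (length u) * 𝟙 (countLe r u + f ≤ᵇ 1)

  cuts : OpenLists → ℕ → List ℕ → ℕ
  cuts [] c π = closedCount nothing c π
  cuts ((a , f) ∷ os) c π = sumSplits π (λ u v → openWeight a f u * cuts os c v)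

  special : ℕ → ℕ
  special m = countLe r (m ∷ [])

  special-≤ : ∀ {b} → b ≤ r → special b ≡ 1
  special-≤ {b} b≤r with b ≤ᵇ r in eq
  ... | true = refl
  ... | false = ⊥-elim (subst T (trans (sym (≤ᵇ-true b≤r)) eq) _)

  special-> : ∀ {b} → r < b → special b ≡ 0
  special-> {b} r<b with b ≤ᵇ r in eq
  ... | false = refl
  ... | true = ⊥-elim (subst T (trans (sym eq) (≤ᵇ-false r<b)) _)

  cutsOpen : ℕ → OpenLists → ℕ → List ℕ → ℕ
  cutsOpen e st zero w = 0
  cutsOpen e st (suc c) w = cuts (st ++ (1 , e) ∷ []) c w

  bumpOpen : ℕ → (OpenLists → ℕ) → OpenLists → ℕ
  bumpOpen e g [] = 0
  bumpOpen e g ((a , f) ∷ os) = g ((suc a , f + e) ∷ os) + bumpOpen e (λ os′ → g ((a , f) ∷ os′)) os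

  openWeight-insert : ∀ a f m u → sumIns m u (openWeight a f) ≡ openWeight (suc a) (f + special m) u
  openWeight-insert a f m u =
    trans (sumIns-const m u (openWeight a f) _ (All.zipWith (λ {π} → weight-insertion {π}) (insertion-length m u , insertion-countLe m r u)))
          (trans (sym (*-assoc (suc (length u)) (fill a (suc (length u))) _))
                 (cong (λ z → suc (length u) * fill a (suc (length u)) * 𝟙 (z ≤ᵇ 1))
                       (trans (+-assoc (countLe r u) (special m) f) (cong (countLe r u +_) (+-comm (special m) f)))))
    where
    weight-insertion : ∀ {π} → length π ≡ suc (length u) × countLe r π ≡ countLe r u + special m →
                       openWeight a f π ≡ fill a (suc (length u)) * 𝟙 (countLe r u + special m + f ≤ᵇ 1)
    weight-insertion (len , cnt) = cong₂ (λ l c → fill a l * 𝟙 (c + f ≤ᵇ 1)) len cnt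

  sumSplits-bumpOpen : ∀ w e (h : List ℕ → ℕ) (K : List ℕ → OpenLists → ℕ) os →
    sumSplits w (λ u v → h u * bumpOpen e (K v) os) ≡ bumpOpen e (λ os′ → sumSplits w (λ u v → h u * K v os′)) os
  sumSplits-bumpOpen w e h K [] = trans (sumSplits-cong′ w (λ u v → *-zeroʳ (h u))) (sumSplits-zero w)
  sumSplits-bumpOpen w e h K ((a , f) ∷ os) =
    trans (sumSplits-cong′ w (λ u v → *-distribˡ-+ (h u) _ _))
          (trans (sumSplits-+ w (λ u v → h u * K v ((suc a , f + e) ∷ os)) (λ u v → h u * bumpOpen e (λ os′ → K v ((a , f) ∷ os′)) os))
                 (cong (sumSplits w (λ u v → h u * K v ((suc a , f + e) ∷ os)) +_) (sumSplits-bumpOpen w e h (λ v os′ → K v ((a , f) ∷ os′)) os)))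

  sumSplits-cutsOpen : ∀ e a f os c w → sumSplits w (λ u v → openWeight a f u * cutsOpen e os c v) ≡ cutsOpen e ((a , f) ∷ os) c w
  sumSplits-cutsOpen e a f os zero w = trans (sumSplits-cong′ w (λ u v → *-zeroʳ (openWeight a f u))) (sumSplits-zero w)
  sumSplits-cutsOpen e a f os (suc c) w = refl

  -- When m is put into the first of the closed lists u it becomes that list's minimum,
  -- so the list becomes a new open list with one removed element.
  insert-first-closed : ∀ m k u v → All (m <_) u → All (m <_) v →
    sumIns m u (λ u′ → firstBlock nothing u′ * closedCount (just (minL u′)) k v) ≡ openWeight 1 (special m) u * closedCount nothing k v
  insert-first-closed m k u v m<u m<v =
    trans (sumIns-const m u _ c (All.zipWith (λ {π} → first {π}) (insertion-length m u , All.zip (insertion-countLe m r u , insertion-minL m u (All.map <⇒≤ m<u)))))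
          (trans (cong (λ z → suc (length u) * (z * N)) (𝟙-∧ (s ≤ᵇ suc (length u)) _))
                 (reassoc (suc (length u)) (𝟙 (s ≤ᵇ suc (length u))) _ N))
    where
    N c : ℕ
    N = closedCount nothing k v
    c = 𝟙 ((s ≤ᵇ suc (length u)) ∧ (countLe r u + special m ≤ᵇ 1)) * N
    first : ∀ {π} → length π ≡ suc (length u) × countLe r π ≡ countLe r u + special m × minL π ≡ m →
            firstBlock nothing π * closedCount (just (minL π)) k v ≡ c
    first {x ∷ xs} (len , cnt , min) =
      cong₂ _*_ (trans (cong 𝟙 (∧-identityʳ (okBlock (x ∷ xs)))) (cong₂ (λ l c → 𝟙 ((s ≤ᵇ l) ∧ (c ≤ᵇ 1))) len cnt))
                (trans (cong (λ z → closedCount (just z) k v) min) (closedCount-unbounded k m v m<v))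
    reassoc : ∀ l x y N → l * (x * y * N) ≡ l * x * y * N
    reassoc = solve-∀

  -- m cannot be put into a later closed list: it would lie below that list's bound.
  insert-later-closed : ∀ m k u v → All (m <_) u → sumIns m v (λ v′ → firstBlock nothing u * closedCount (just (minL u)) k v′) ≡ 0
  insert-later-closed m k [] v _ = sumIns-zero m v _ (All.map (λ _ → refl) (insertion-length m v))
  insert-later-closed m k (x ∷ xs) v m<u = sumIns-zero m v _ (All.map (λ {v′} → vanish {v′}) (insertion-∈ m v))
    where
    vanish : ∀ {v′} → m ∈ v′ → firstBlock nothing (x ∷ xs) * closedCount (just (minL (x ∷ xs))) k v′ ≡ 0
    vanish m∈v′ = trans (cong (firstBlock nothing (x ∷ xs) *_) (closedCount-vanish k _ _ m∈v′ (minL-lb (x ∷ xs) (λ ()) m<u)))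
                        (*-zeroʳ (firstBlock nothing (x ∷ xs)))

  -- Summed over the
  -- positions of m in w, the cuttings of type (st, c) are those where m opens a new
  -- list (it is then the minimum of a list not yet opened) plus those where m joins
  -- one of the open lists.
  cuts-insert : ∀ m w st c → All (m <_) w →
    sumIns m w (cuts st c) ≡ cutsOpen (special m) st c w + bumpOpen (special m) (λ st′ → cuts st′ c w) st
  cuts-insert m w [] zero m<w = sumIns-zero m w _ (All.map (λ {π} → nonempty {π}) (insertion-length m w))
    where
    nonempty : ∀ {π} → length π ≡ suc (length w) → closedCount nothing zero π ≡ 0
    nonempty {x ∷ xs} _ = refl
  cuts-insert m w [] (suc k) m<w = begin
    sumIns m w (λ π → sumSplits π (λ u v → firstBlock nothing u * closedCount (just (minL u)) k v))
      ≡⟨ sumIns-sumSplits m w _ ⟩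
    sumSplits w (λ u v → sumIns m u (λ u′ → firstBlock nothing u′ * closedCount (just (minL u′)) k v)
                       + sumIns m v (λ v′ → firstBlock nothing u * closedCount (just (minL u)) k v′))
      ≡⟨ sumSplits-cong w into-first ⟩
    sumSplits w (λ u v → openWeight 1 (special m) u * closedCount nothing k v)
      ≡⟨ sym (+-identityʳ _) ⟩
    cutsOpen (special m) [] (suc k) w + 0 ∎
    where
    open ≡-Reasoning
    into-first : ∀ u v → u ++ v ≡ w →
      sumIns m u (λ u′ → firstBlock nothing u′ * closedCount (just (minL u′)) k v) + sumIns m v (λ v′ → firstBlock nothing u * closedCount (just (minL u)) k v′)
        ≡ openWeight 1 (special m) u * closedCount nothing k v
    into-first u v e with All.++⁻ u (subst (All (m <_)) (sym e) m<w)
    ... | m<u , m<v = trans (cong₂ _+_ (insert-first-closed m k u v m<u m<v) (insert-later-closed m k u v m<u)) (+-identityʳ _)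
  cuts-insert m w ((a , f) ∷ os) c m<w = begin
    sumIns m w (λ π → sumSplits π (λ u v → openWeight a f u * cuts os c v))
      ≡⟨ sumIns-sumSplits m w _ ⟩
    sumSplits w (λ u v → sumIns m u (λ u′ → openWeight a f u′ * cuts os c v) + sumIns m v (λ v′ → openWeight a f u * cuts os c v′))
      ≡⟨ sumSplits-cong w into-parts ⟩
    sumSplits w (λ u v → openWeight (suc a) (f + e) u * cuts os c v + (openWeight a f u * cutsOpen e os c v + openWeight a f u * bumpOpen e (λ st′ → cuts st′ c v) os))
      ≡⟨ sumSplits-+ w _ _ ⟩
    A + sumSplits w (λ u v → openWeight a f u * cutsOpen e os c v + openWeight a f u * bumpOpen e (λ st′ → cuts st′ c v) os)
      ≡⟨ cong (A +_) (sumSplits-+ w _ _) ⟩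
    A + (sumSplits w (λ u v → openWeight a f u * cutsOpen e os c v) + sumSplits w (λ u v → openWeight a f u * bumpOpen e (λ st′ → cuts st′ c v) os))
      ≡⟨ cong₂ (λ x y → A + (x + y)) (sumSplits-cutsOpen e a f os c w) (sumSplits-bumpOpen w e (openWeight a f) (λ v st′ → cuts st′ c v) os) ⟩
    A + (O + B)
      ≡⟨ +-left-comm A O B ⟩
    cutsOpen e ((a , f) ∷ os) c w + bumpOpen e (λ st′ → cuts st′ c w) ((a , f) ∷ os) ∎
    where
    open ≡-Reasoning
    e : ℕ
    e = special m
    A O B : ℕ
    A = sumSplits w (λ u v → openWeight (suc a) (f + e) u * cuts os c v)
    O = cutsOpen e ((a , f) ∷ os) c w
    B = bumpOpen e (λ os′ → sumSplits w (λ u v → openWeight a f u * cuts os′ c v)) os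
    into-parts : ∀ u v → u ++ v ≡ w →
      sumIns m u (λ u′ → openWeight a f u′ * cuts os c v) + sumIns m v (λ v′ → openWeight a f u * cuts os c v′)
        ≡ openWeight (suc a) (f + e) u * cuts os c v + (openWeight a f u * cutsOpen e os c v + openWeight a f u * bumpOpen e (λ st′ → cuts st′ c v) os)
    into-parts u v eq = cong₂ _+_
      (trans (∑-*ʳ (insertions m u) (cuts os c v) (openWeight a f)) (cong (_* cuts os c v) (openWeight-insert a f m u)))
      (trans (∑-*ˡ (insertions m v) (openWeight a f u) (cuts os c))
             (trans (cong (openWeight a f u *_) (cuts-insert m v os c (proj₂ (All.++⁻ u (subst (All (m <_)) (sym eq) m<w)))))
                    (*-distribˡ-+ (openWeight a f u) _ _)))

  countPerms : List ℕ → OpenLists → ℕ → ℕ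
  countPerms ys st c = ∑ (perms ys) (cuts st c)

  countPermsOpen : ℕ → OpenLists → ℕ → List ℕ → ℕ
  countPermsOpen e st zero ys = 0
  countPermsOpen e st (suc c) ys = countPerms ys (st ++ (1 , e) ∷ []) c

  -- Removing the smallest element m: the permutations of m ∷ ys arise by inserting
  -- m into the permutations of ys, so cuts-insert applies termwise.
  countPerms-step : ∀ m ys st c → All (m <_) ys →
    countPerms (m ∷ ys) st c ≡ countPermsOpen (special m) st c ys + bumpOpen (special m) (λ st′ → countPerms ys st′ c) st
  countPerms-step m ys st c m<ys = begin
    ∑ (concatMap (insertions m) (perms ys)) (cuts st c)
      ≡⟨ ∑-concatMap (perms ys) (insertions m) (cuts st c) ⟩
    ∑ (perms ys) (λ π → sumIns m π (cuts st c))
      ≡⟨ ∑-cong (perms ys) (All.map (λ {π} → cuts-insert m π st c) (perms-All ys m<ys)) ⟩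
    ∑ (perms ys) (λ π → cutsOpen e st c π + bumpOpen e (λ st′ → cuts st′ c π) st)
      ≡⟨ ∑-+ (perms ys) _ _ ⟩
    ∑ (perms ys) (cutsOpen e st c) + ∑ (perms ys) (λ π → bumpOpen e (λ st′ → cuts st′ c π) st)
      ≡⟨ cong₂ _+_ (∑-cutsOpen c) (∑-bumpOpen (perms ys) (λ π st′ → cuts st′ c π) st) ⟩
    countPermsOpen e st c ys + bumpOpen e (λ st′ → countPerms ys st′ c) st ∎
    where
    open ≡-Reasoning
    e : ℕ
    e = special m
    perms-All : {P : ℕ → Set} → ∀ ys → All P ys → All (All P) (perms ys)
    perms-All [] [] = [] ∷ []
    perms-All (x ∷ xs) (px ∷ pxs) = All.concat⁺ (All.map⁺ (All.map (λ {π} → insertion-All x π px) (perms-All xs pxs)))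
    ∑-cutsOpen : ∀ c → ∑ (perms ys) (cutsOpen e st c) ≡ countPermsOpen e st c ys
    ∑-cutsOpen zero = ∑-zero (perms ys)
    ∑-cutsOpen (suc c) = refl
    ∑-bumpOpen : (πs : List (List ℕ)) (K : List ℕ → OpenLists → ℕ) (os : OpenLists) →
                 ∑ πs (λ π → bumpOpen e (K π) os) ≡ bumpOpen e (λ os′ → ∑ πs (λ π → K π os′)) os
    ∑-bumpOpen πs K [] = ∑-zero πs
    ∑-bumpOpen πs K ((a , f) ∷ os) =
      trans (∑-+ πs _ _) (cong (∑ πs (λ π → K π ((suc a , f + e) ∷ os)) +_) (∑-bumpOpen πs (λ π os′ → K π ((a , f) ∷ os′)) os))

  range : ℕ → ℕ → List ℕ
  range b zero = []
  range b (suc n) = b ∷ range (suc b) n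

  oneTo≡range : ∀ N → oneTo N ≡ range 1 N
  oneTo≡range N = trans (map-upTo suc N) (applyUpTo≡range N suc 1 (λ i → refl))
    where
    applyUpTo≡range : ∀ n (f : ℕ → ℕ) b → (∀ i → f i ≡ b + i) → applyUpTo f n ≡ range b n
    applyUpTo≡range zero f b h = refl
    applyUpTo≡range (suc n) f b h =
      cong₂ _∷_ (trans (h 0) (+-identityʳ b)) (applyUpTo≡range n (f ∘ suc) (suc b) (λ i → trans (h (suc i)) (+-suc b i)))

  range-above : ∀ b n → All (b <_) (range (suc b) n)
  range-above b zero = []
  range-above b (suc n) = ≤-refl ∷ All.map (<-trans (n<1+n b)) (range-above (suc b) n)

  countPerms-range : ∀ b n st c → countPerms (range b (suc n)) st c
    ≡ countPermsOpen (special b) st c (range (suc b) n) + bumpOpen (special b) (λ st′ → countPerms (range (suc b) n) st′ c) st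
  countPerms-range b n st c = countPerms-step b (range (suc b) n) st c (range-above b n)

  allowed : OpenLists → ℕ
  allowed [] = 1
  allowed ((a , f) ∷ os) = 𝟙 (f ≤ᵇ 1) * allowed os

  cuts-[] : ∀ st c → cuts st c [] ≡ allowed st * grow 0 (map proj₁ st) c
  cuts-[] [] zero = refl
  cuts-[] [] (suc c) = refl
  cuts-[] ((a , f) ∷ os) c = begin
    fill a 0 * 𝟙 (f ≤ᵇ 1) * cuts os c []
      ≡⟨ cong (fill a 0 * 𝟙 (f ≤ᵇ 1) *_) (cuts-[] os c) ⟩
    fill a 0 * 𝟙 (f ≤ᵇ 1) * (allowed os * grow 0 (map proj₁ os) c)
      ≡⟨ shuffle (fill a 0) (𝟙 (f ≤ᵇ 1)) (allowed os) (grow 0 (map proj₁ os) c) ⟩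
    𝟙 (f ≤ᵇ 1) * allowed os * (fill a 0 * grow 0 (map proj₁ os) c)
      ≡⟨ cong (𝟙 (f ≤ᵇ 1) * allowed os *_) (grow₀-∷ c) ⟩
    𝟙 (f ≤ᵇ 1) * allowed os * grow 0 (a ∷ map proj₁ os) c ∎
    where
    open ≡-Reasoning
    shuffle : ∀ p q x y → p * q * (x * y) ≡ q * x * (p * y)
    shuffle = solve-∀
    grow₀-∷ : ∀ c → fill a 0 * grow 0 (map proj₁ os) c ≡ grow 0 (a ∷ map proj₁ os) c
    grow₀-∷ zero = refl
    grow₀-∷ (suc c) = *-zeroʳ (fill a 0)

  -- Once all special elements are gone (b > r), each remaining element opens a new
  -- list or joins an open one, exactly as in the recursion grow.
  after-special : ∀ n b st c → r < b → countPerms (range b n) st c ≡ allowed st * grow n (map proj₁ st) c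
  after-special zero b st c r<b = trans (+-identityʳ (cuts st c [])) (cuts-[] st c)
  after-special (suc n) b st c r<b = begin
    countPerms (range b (suc n)) st c
      ≡⟨ countPerms-range b n st c ⟩
    countPermsOpen (special b) st c (range (suc b) n) + bumpOpen (special b) (λ st′ → countPerms (range (suc b) n) st′ c) st
      ≡⟨ cong (λ e → countPermsOpen e st c (range (suc b) n) + bumpOpen e (λ st′ → countPerms (range (suc b) n) st′ c) st) (special-> r<b) ⟩
    countPermsOpen 0 st c (range (suc b) n) + bumpOpen 0 (λ st′ → countPerms (range (suc b) n) st′ c) st
      ≡⟨ cong₂ _+_ (open-new c) (bumpOpen-plain (λ st′ → countPerms (range (suc b) n) st′ c) (λ xs → grow n xs c) st (λ st′ → IH st′ c)) ⟩
    allowed st * growOpen n (map proj₁ st) c + allowed st * bump (λ xs → grow n xs c) (map proj₁ st)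
      ≡⟨ sym (*-distribˡ-+ (allowed st) _ _) ⟩
    allowed st * grow (suc n) (map proj₁ st) c ∎
    where
    open ≡-Reasoning
    IH : ∀ st′ c′ → countPerms (range (suc b) n) st′ c′ ≡ allowed st′ * grow n (map proj₁ st′) c′
    IH st′ c′ = after-special n (suc b) st′ c′ (<-trans r<b (n<1+n b))
    allowed-new : ∀ st → allowed (st ++ (1 , 0) ∷ []) ≡ allowed st
    allowed-new [] = refl
    allowed-new ((a , f) ∷ os) = cong (𝟙 (f ≤ᵇ 1) *_) (allowed-new os)
    open-new : ∀ c → countPermsOpen 0 st c (range (suc b) n) ≡ allowed st * growOpen n (map proj₁ st) c
    open-new zero = sym (*-zeroʳ (allowed st))
    open-new (suc c) = trans (IH (st ++ (1 , 0) ∷ []) c)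
                             (cong₂ (λ x y → x * grow n y c) (allowed-new st) (map-++ proj₁ st ((1 , 0) ∷ [])))
    bumpOpen-plain : ∀ (g : OpenLists → ℕ) (h : List ℕ → ℕ) st → (∀ st′ → g st′ ≡ allowed st′ * h (map proj₁ st′)) →
                     bumpOpen 0 g st ≡ allowed st * bump h (map proj₁ st)
    bumpOpen-plain g h [] e = refl
    bumpOpen-plain g h ((a , f) ∷ os) e = begin
      g ((suc a , f + 0) ∷ os) + bumpOpen 0 (λ os′ → g ((a , f) ∷ os′)) os
        ≡⟨ cong₂ _+_ (trans (cong (λ z → g ((suc a , z) ∷ os)) (+-identityʳ f)) (e ((suc a , f) ∷ os)))
                     (bumpOpen-plain (λ os′ → g ((a , f) ∷ os′)) (λ xs → ok * h (a ∷ xs)) os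
                                     (λ st′ → trans (e ((a , f) ∷ st′)) (*-assoc-comm ok (allowed st′) _))) ⟩
      ok * allowed os * h (suc a ∷ map proj₁ os) + allowed os * bump (λ xs → ok * h (a ∷ xs)) (map proj₁ os)
        ≡⟨ cong (λ z → ok * allowed os * h (suc a ∷ map proj₁ os) + allowed os * z) (bump-*ˡ ok (λ xs → h (a ∷ xs)) (map proj₁ os)) ⟩
      ok * allowed os * h (suc a ∷ map proj₁ os) + allowed os * (ok * bump (λ xs → h (a ∷ xs)) (map proj₁ os))
        ≡⟨ factor ok (allowed os) (h (suc a ∷ map proj₁ os)) _ ⟩
      ok * allowed os * (h (suc a ∷ map proj₁ os) + bump (λ xs → h (a ∷ xs)) (map proj₁ os)) ∎
      where
      ok : ℕ
      ok = 𝟙 (f ≤ᵇ 1)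
      *-assoc-comm : ∀ p q x → p * q * x ≡ q * (p * x)
      *-assoc-comm = solve-∀
      factor : ∀ p q x y → p * q * x + q * (p * y) ≡ p * q * (x + y)
      factor = solve-∀

  Overfull : ℕ × ℕ → Set
  Overfull (a , f) = 2 ≤ f

  allowed-overfull : ∀ st → Any Overfull st → allowed st ≡ 0
  allowed-overfull ((a , f) ∷ os) (here 2≤f) = cong (λ z → 𝟙 z * allowed os) (≤ᵇ-false 2≤f)
  allowed-overfull ((a , f) ∷ os) (there p) = trans (cong (𝟙 (f ≤ᵇ 1) *_) (allowed-overfull os p)) (*-zeroʳ (𝟙 (f ≤ᵇ 1)))

  bumpOpen-zero : ∀ e (g : OpenLists → ℕ) st → (∀ st′ → g st′ ≡ 0) → bumpOpen e g st ≡ 0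
  bumpOpen-zero e g [] h = refl
  bumpOpen-zero e g ((a , f) ∷ os) h = cong₂ _+_ (h _) (bumpOpen-zero e _ os (λ st′ → h _))

  bumpOpen-overfull : ∀ e (g : OpenLists → ℕ) st → Any Overfull st → (∀ st′ → Any Overfull st′ → g st′ ≡ 0) → bumpOpen e g st ≡ 0
  bumpOpen-overfull e g ((a , f) ∷ os) (here 2≤f) h =
    cong₂ _+_ (h _ (here (≤-trans 2≤f (m≤m+n f e)))) (bumpOpen-zero e _ os (λ st′ → h _ (here 2≤f)))
  bumpOpen-overfull e g ((a , f) ∷ os) (there p) h =
    cong₂ _+_ (h _ (there p)) (bumpOpen-overfull e _ os p (λ st′ q → h _ (there q)))

  overfull-vanish : ∀ n b st c → Any Overfull st → countPerms (range b n) st c ≡ 0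
  overfull-vanish zero b st c p = trans (+-identityʳ (cuts st c [])) (trans (cuts-[] st c) (cong (_* grow 0 (map proj₁ st) c) (allowed-overfull st p)))
  overfull-vanish (suc n) b st c p =
    trans (countPerms-range b n st c)
          (cong₂ _+_ (open-new c) (bumpOpen-overfull (special b) _ st p (λ st′ q → overfull-vanish n (suc b) st′ c q)))
    where
    open-new : ∀ c → countPermsOpen (special b) st c (range (suc b) n) ≡ 0
    open-new zero = refl
    open-new (suc c) = overfull-vanish n (suc b) _ c (Any.++⁺ˡ p)

  -- The special elements 1,…,r come first.  With j of them processed, each in its
  -- own open list, the next one must open a new list: joining an open list would
  -- put two special elements together.
  special-first : ∀ n k t j → j + t ≡ r → countPerms (range (suc j) (t + n)) (replicate j (1 , 1)) (t + k) ≡ grow n (replicate r 1) k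
  special-first n k zero j j+0≡r = begin
    countPerms (range (suc j) n) (replicate j (1 , 1)) k
      ≡⟨ after-special n (suc j) (replicate j (1 , 1)) k (s≤s (≤-reflexive (sym j≡r))) ⟩
    allowed (replicate j (1 , 1)) * grow n (map proj₁ (replicate j (1 , 1))) k
      ≡⟨ cong₂ (λ x y → x * grow n y k) (allowed-singletons j) (map-replicate proj₁ j (1 , 1)) ⟩
    1 * grow n (replicate j 1) k
      ≡⟨ trans (*-identityˡ _) (cong (λ z → grow n (replicate z 1) k) j≡r) ⟩
    grow n (replicate r 1) k ∎
    where
    open ≡-Reasoning
    j≡r : j ≡ r
    j≡r = trans (sym (+-identityʳ j)) j+0≡r
    allowed-singletons : ∀ j → allowed (replicate j (1 , 1)) ≡ 1
    allowed-singletons zero = refl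
    allowed-singletons (suc j) = cong (1 *_) (allowed-singletons j)
  special-first n k (suc t) j j+t+1≡r = begin
    countPerms (range (suc j) (suc (t + n))) st (suc (t + k))
      ≡⟨ countPerms-range (suc j) (t + n) st (suc (t + k)) ⟩
    countPermsOpen (special (suc j)) st (suc (t + k)) R + bumpOpen (special (suc j)) (λ st′ → countPerms R st′ (suc (t + k))) st
      ≡⟨ cong (λ e → countPermsOpen e st (suc (t + k)) R + bumpOpen e (λ st′ → countPerms R st′ (suc (t + k))) st) (special-≤ j<r) ⟩
    countPerms R (st ++ (1 , 1) ∷ []) (t + k) + bumpOpen 1 (λ st′ → countPerms R st′ (suc (t + k))) st
      ≡⟨ cong₂ _+_ (cong (λ z → countPerms R z (t + k)) (replicate-snoc j))
                   (no-second-special j (λ st′ → countPerms R st′ (suc (t + k)))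
                                        (λ st′ → overfull-vanish (t + n) (suc (suc j)) st′ (suc (t + k)))) ⟩
    countPerms R (replicate (suc j) (1 , 1)) (t + k) + 0
      ≡⟨ +-identityʳ _ ⟩
    countPerms R (replicate (suc j) (1 , 1)) (t + k)
      ≡⟨ special-first n k t (suc j) (trans (sym (+-suc j t)) j+t+1≡r) ⟩
    grow n (replicate r 1) k ∎
    where
    open ≡-Reasoning
    st : OpenLists
    st = replicate j (1 , 1)
    R : List ℕ
    R = range (suc (suc j)) (t + n)
    j<r : suc j ≤ r
    j<r = subst (suc j ≤_) (trans (sym (+-suc j t)) j+t+1≡r) (m≤m+n (suc j) t)
    replicate-snoc : ∀ j → replicate j (1 , 1) ++ (1 , 1) ∷ [] ≡ replicate (suc j) (1 , 1)
    replicate-snoc zero = refl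
    replicate-snoc (suc j) = cong ((1 , 1) ∷_) (replicate-snoc j)
    no-second-special : ∀ j (g : OpenLists → ℕ) → (∀ st′ → Any Overfull st′ → g st′ ≡ 0) → bumpOpen 1 g (replicate j (1 , 1)) ≡ 0
    no-second-special zero g h = refl
    no-second-special (suc j) g h = cong₂ _+_ (h _ (here ≤-refl)) (no-second-special j _ (λ st′ q → h _ (there q)))

  L≡grow : ∀ n k → L s r (n + r) (k + r) ≡ grow n (replicate r 1) k
  L≡grow n k = begin
    L s r (n + r) (k + r)                          ≡⟨ L≡∑closedCount (n + r) (k + r) ⟩
    countPerms (oneTo (n + r)) [] (k + r)          ≡⟨ cong₂ (λ N K → countPerms N [] K) (trans (oneTo≡range (n + r)) (cong (range 1) (+-comm n r))) (+-comm k r) ⟩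
    countPerms (range 1 (r + n)) [] (r + k)        ≡⟨ special-first n k r 0 refl ⟩
    grow n (replicate r 1) k ∎
    where open ≡-Reasoning

prodL≡prodGrow : ∀ s {p} (ks rs ls : Vec ℕ p) → prodL s ks rs ls ≡ Growth.prodGrow s ks rs ls
prodL≡prodGrow s [] [] [] = refl
prodL≡prodGrow s (k ∷ ks) (r ∷ rs) (l ∷ ls) = cong₂ _*_ (Enumeration.L≡grow s r l k) (prodL≡prodGrow s ks rs ls)

rhsSum≡∑ : ∀ s p n (ks rs : Vec ℕ p) → rhsSum s n ks rs ≡ ∑ (weakComps p n) (λ ls → multinomial ls * Growth.prodGrow s ks rs ls)
rhsSum≡∑ s p n ks rs =
  trans (∑-filter (admissible s ks rs) (λ ls → multinomial ls * prodL s ks rs ls) (weakComps p n) inadmissible)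
        (∑-cong′ (weakComps p n) (λ ls → cong (multinomial ls *_) (prodL≡prodGrow s ks rs ls)))
  where
  inadmissible : ∀ ls → admissible s ks rs ls ≡ false → multinomial ls * prodL s ks rs ls ≡ 0
  inadmissible ls bad = trans (cong (multinomial ls *_) (trans (prodL≡prodGrow s ks rs ls) (Growth.inadmissible-vanish s ks rs ls bad)))
                              (*-zeroʳ (multinomial ls))

mainTheorem17 : (p : ℕ) → 1 ≤ p → (ks rs : Vec ℕ p) → (s : ℕ) → 1 ≤ s → (n : ℕ) → s * sum ks ≤ n →
    multinomial ks * L s (sum rs) (n + sum rs) (sum ks + sum rs) ≡ rhsSum s n ks rs
mainTheorem17 p _ ks rs s _ n _ = begin
  multinomial ks * L s (sum rs) (n + sum rs) (sum ks + sum rs)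
    ≡⟨ cong (multinomial ks *_) (L≡grow n (sum ks)) ⟩
  multinomial ks * grow n (replicate (sum rs) 1) (sum ks)
    ≡⟨ multinomial-convolution p n ks rs ⟨
  ∑ (weakComps p n) (λ ls → multinomial ls * prodGrow ks rs ls)
    ≡⟨ rhsSum≡∑ s p n ks rs ⟨
  rhsSum s n ks rs ∎
  where
  open ≡-Reasoning
  open Growth s
  open Enumeration s (sum rs)
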